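{- Let $q$ be a prime power, $N_0=(\Gamma_q)^n$ with $\Gamma_q$ as defined below, and $t$ a positive integer. Let $x_1,\dots,x_L\in\mathbb{F}_q^n$ be pairwise distinct, let $y_1,\dots,y_L\in\mathbb{F}_q^n$ be pairwise distinct, and let $\alpha,\beta\in\mathbb{F}_q\setminus\{0\}$. If $L\ge 4tN_0$, then there exists $i\in[L]$ such that $\left|\{(i',i'')\in([L]\setminus\{i\})^2 : \alpha x_{i'}+\beta y_{i''}=\alpha x_i+\beta y_i\}\right|\ge t.$
   Context: For an integer $t'\ge2$ let $J(t')=\frac1{t'}\min_{0<x<1}\frac{1+x+\dots+x^{t'-1}}{x^{(t'-1)/3}}$ and $\Gamma_q=qJ(q)$. -}

module Defs where

open import Level using (0ℓ)
open import Data.Nat as ℕ using (ℕ; zero; suc; _∸_)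
open import Data.Nat.Primality using (Prime)
open import Data.Integer using (+_)
open import Data.Rational as ℚ using (ℚ; 0ℚ; 1ℚ; _<_)
open import Data.Fin using (Fin)
open import Data.Vec using (Vec; map; zipWith)
open import Data.Product using (Σ; ∃; ∃-syntax; _×_; _,_)
open import Relation.Binary.PropositionalEquality using (_≡_; _≢_)
open import Algebra.Structures using (IsCommutativeRing)
open import Function.Bundles using (_↔_)

IsPrimePower : ℕ → Set
IsPrimePower q = ∃[ p ] ∃[ k ] (Prime p × 1 ℕ.≤ k × q ≡ p ℕ.^ k)

record FiniteField (q : ℕ) : Set₁ where
  infixl 7 _*_
  infixl 6 _+_
  field
    Carrier : Set
    _+_ _*_ : Carrier → Carrier → Carrier
    -_      : Carrier → Carrier
    0# 1#   : Carrier
    isCommutativeRing : IsCommutativeRing _≡_ _+_ _*_ -_ 0# 1#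
    0≢1     : 0# ≢ 1#
    inverse : ∀ a → a ≢ 0# → ∃[ b ] (a * b ≡ 1#)
    enumeration : Fin q ↔ Carrier

module _ {q : ℕ} (F : FiniteField q) where
  open FiniteField F

  Vecₙ : ℕ → Set
  Vecₙ n = Vec Carrier n

  scale : ∀ {n} → Carrier → Vecₙ n → Vecₙ n
  scale a v = map (a *_) v

  vadd : ∀ {n} → Vecₙ n → Vecₙ n → Vecₙ n
  vadd = zipWith _+_

-- The constant Γ_q, encoded over ℚ (there are no real numbers).
--
-- Γ_q = q J(q) = min_{0<x<1} (1 + x + … + x^{q-1}) / x^{(q-1)/3}.

powℚ : ℚ → ℕ → ℚ
powℚ x zero    = 1ℚ
powℚ x (suc k) = x ℚ.* powℚ x k

geomSum : ℚ → ℕ → ℚ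
geomSum x zero    = 0ℚ
geomSum x (suc k) = powℚ x k ℚ.+ geomSum x k

ℕtoℚ : ℕ → ℚ
ℕtoℚ m = + m ℚ./ 1

-- "(Γ_q)^n < a / b" for rationals a > 0, b > 0:  there is a rational x in
-- (0,1) with ((1+…+x^{q-1}) / x^{(q-1)/3})^n < a / b, written without cube
-- roots or division as  b^3 · (1+…+x^{q-1})^{3n} < a^3 · x^{n(q-1)}.
-- (The infimum over rational x equals the minimum over real x by
-- continuity and density, so this is exactly (Γ_q)^n < a / b.)
GammaPowLt : (q n : ℕ) → (a b : ℚ) → Set
GammaPowLt q n a b =
  ∃[ x ] (0ℚ < x × x < 1ℚ ×
          powℚ b 3 ℚ.* powℚ (geomSum x q) (3 ℕ.* n)
            < powℚ a 3 ℚ.* powℚ x (n ℕ.* (q ∸ 1)))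

-- "L ≥ 4 t (Γ_q)^n", i.e. "L ≥ 4 t N₀" with N₀ = (Γ_q)^n (t ≥ 1):
-- for every rational ε > 0, (Γ_q)^n < (L + ε) / (4t).
-- (Equivalent to the non-strict real inequality since ε is arbitrary.)
LGe4tN₀ : (q n t L : ℕ) → Set
LGe4tN₀ q n t L =
  ∀ (ε : ℚ) → 0ℚ < ε → GammaPowLt q n (ℕtoℚ L ℚ.+ ε) (ℕtoℚ (4 ℕ.* t))

-- Suppose every i has fewer than t solutions. Draw an edge c → a whenever
-- α x_a + β y_b = α x_c + β y_c for some b, with a, b ≠ c. This digraph has out-degree below t,
-- so repeatedly keeping a vertex of small in-degree and deleting its neighbours yields an
-- independent set S with L ≤ (2t - 1) |S|. On S only the trivial solutions remain, so
-- (α x_a, β y_b, -(α x_c + β y_c)) is a tricoloured sum-free family, and so are its tensor powers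
-- S^k in F_q^(kn). The slice-rank method bounds such a family in F_q^N by three times the number
-- of exponent vectors in {0, …, q-1}^N with sum at most N (q - 1) / 3, and a Chernoff-type count
-- bounds that number by Γ_q^N. Letting k → ∞ removes the factor 3, so |S| ≤ Γ_q^n, which
-- contradicts L ≥ 4 t Γ_q^n.
module Submission where

open import Algebra.Bundles using (CommutativeSemiring)
open import Data.Nat using (ℕ)
open import Data.Fin using (Fin)
open import Relation.Nullary using (Dec)
open import Defs

module Lists where

  open import Data.Nat using (ℕ; zero; suc; _+_; _*_; _^_)
  import Data.Fin as Fin
  open import Data.List using (List; []; _∷_; [_]; map; length; filter; lookup; cartesianProductWith)
  open import Data.List.Properties using (filter-all; length-++; length-map)
  open import Data.List.Membership.Propositional using (_∈_)
  open import Data.List.Membership.Propositional.Properties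
    using (∈-cartesianProductWith⁺; ∈-cartesianProductWith⁻; ∈-lookup; ∈-filter⁻)
  open import Data.List.Relation.Unary.Any using (here; there)
  open import Data.List.Relation.Unary.All as All using (All)
  open import Data.List.Relation.Unary.Unique.Propositional using (Unique; []; _∷_)
  open import Data.List.Relation.Unary.Unique.Propositional.Properties using (cartesianProductWith⁺; filter⁺)
  open import Data.Vec using (Vec; []; _∷_)
  open import Data.Vec.Properties using (∷-injective)
  open import Data.Vec.Relation.Unary.All as VecAll using ([]; _∷_)
  open import Data.Product using (_×_; _,_)
  open import Relation.Binary.PropositionalEquality using (_≡_; _≢_; refl; sym; trans; cong; cong₂; ≢-sym)
  open import Function using (_∘_)
  open import Relation.Binary.Definitions using (DecidableEquality)
  open import Relation.Nullary using (¬?; yes; no; contradiction)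

  private
    variable
      A : Set
      x : A
      xs : List A

  allVecs : List A → (n : ℕ) → List (Vec A n)
  allVecs xs zero    = [ [] ]
  allVecs xs (suc n) = cartesianProductWith _∷_ xs (allVecs xs n)

  ∈-allVecs⁺ : ∀ {n} {v : Vec A n} → VecAll.All (_∈ xs) v → v ∈ allVecs xs n
  ∈-allVecs⁺ []       = here refl
  ∈-allVecs⁺ (p ∷ ps) = ∈-cartesianProductWith⁺ _∷_ p (∈-allVecs⁺ ps)

  ∈-allVecs⁻ : ∀ {n} {v : Vec A n} → v ∈ allVecs xs n → VecAll.All (_∈ xs) v
  ∈-allVecs⁻ {n = zero} {[]} _ = []
  ∈-allVecs⁻ {xs = xs} {n = suc n} p with ∈-cartesianProductWith⁻ _∷_ xs (allVecs xs n) p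
  ... | _ , _ , a∈xs , w∈allVecs , refl = a∈xs ∷ ∈-allVecs⁻ w∈allVecs

  allVecs⁺ : ∀ n → Unique xs → Unique (allVecs xs n)
  allVecs⁺ zero    _   = All.[] ∷ []
  allVecs⁺ (suc n) xs! = cartesianProductWith⁺ _∷_ ∷-injective xs! (allVecs⁺ n xs!)

  length-cartesianProductWith : ∀ {B C : Set} (f : A → B → C) xs (ys : List B) →
    length (cartesianProductWith f xs ys) ≡ length xs * length ys
  length-cartesianProductWith f []       ys = refl
  length-cartesianProductWith f (x ∷ xs) ys = trans (length-++ (map (f x) ys))
    (cong₂ _+_ (length-map (f x) ys) (length-cartesianProductWith f xs ys))

  length-allVecs : ∀ (xs : List A) n → length (allVecs xs n) ≡ length xs ^ n
  length-allVecs xs zero    = refl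
  length-allVecs xs (suc n) = trans (length-cartesianProductWith _∷_ xs (allVecs xs n))
    (cong (length xs *_) (length-allVecs xs n))

  lookup-injective : Unique xs → ∀ i j → lookup xs i ≡ lookup xs j → i ≡ j
  lookup-injective (_ ∷ _)      Fin.zero    Fin.zero    _  = refl
  lookup-injective (x≢xs ∷ _)   Fin.zero    (Fin.suc j) eq = contradiction eq (All.lookup x≢xs (∈-lookup j))
  lookup-injective (x≢xs ∷ _)   (Fin.suc i) Fin.zero    eq = contradiction (sym eq) (All.lookup x≢xs (∈-lookup i))
  lookup-injective (_ ∷ xs!)    (Fin.suc i) (Fin.suc j) eq = cong Fin.suc (lookup-injective xs! i j eq)

  module _ (_≟_ : DecidableEquality A) where

    without : A → List A → List A
    without x = filter (λ y → ¬? (y ≟ x))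

    length-without : Unique xs → x ∈ xs → length xs ≡ suc (length (without x xs))
    length-without {xs = y ∷ ys} (y≢ys ∷ _) (here refl) with y ≟ y
    ... | yes _   = cong (suc ∘ length) (sym (filter-all (λ z → ¬? (z ≟ y)) (All.map ≢-sym y≢ys)))
    ... | no y≢y  = contradiction refl y≢y
    length-without {xs = y ∷ ys} {x} (y≢ys ∷ ys!) (there x∈ys) with y ≟ x
    ... | yes refl = contradiction refl (All.lookup y≢ys x∈ys)
    ... | no _     = cong suc (length-without ys! x∈ys)

    ∈-without⁻ : ∀ {x y} {xs} → y ∈ without x xs → y ∈ xs × y ≢ x
    ∈-without⁻ {x} = ∈-filter⁻ (λ y → ¬? (y ≟ x))

    without⁺ : ∀ {x} {xs} → Unique xs → Unique (without x xs)
    without⁺ {x} = filter⁺ (λ y → ¬? (y ≟ x))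

module Sum {c ℓ} (R : CommutativeSemiring c ℓ) where

  open import Data.Nat using (suc)
  open import Data.List using (List; []; _∷_; _++_; map; cartesianProductWith)
  open import Data.List.Membership.Propositional using (_∈_; _∉_)
  open import Data.List.Relation.Unary.Any using (here; there)
  open import Data.List.Relation.Unary.Unique.Propositional using (Unique; _∷_)
  import Data.List.Relation.Unary.All as All
  open import Data.Vec as Vec using (Vec; []; _∷_)
  open import Function using (_∘_)
  import Relation.Binary.PropositionalEquality as ≡
  open import Relation.Binary.Definitions using (DecidableEquality)
  open import Relation.Nullary using (Dec; yes; no; contradiction)
  open Lists using (allVecs)

  open CommutativeSemiring R
  open import Algebra.Properties.CommutativeSemigroup +-commutativeSemigroup using (interchange)
  open import Relation.Binary.Reasoning.Setoid setoid

  private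
    variable
      X Y Z : Set

  ∑ : List X → (X → Carrier) → Carrier
  ∑ []       f = 0#
  ∑ (x ∷ xs) f = f x + ∑ xs f

  syntax ∑ xs (λ x → e) = ∑[ x ← xs ] e

  ∏ : ∀ {n} → Vec Carrier n → Carrier
  ∏ []       = 1#
  ∏ (r ∷ rs) = r * ∏ rs

  when : ∀ {P : Set} → Dec P → Carrier → Carrier
  when (yes _) r = r
  when (no _)  _ = 0#

  ∑-cong-∈ : ∀ (xs : List X) {f g : X → Carrier} → (∀ {x} → x ∈ xs → f x ≈ g x) → ∑ xs f ≈ ∑ xs g
  ∑-cong-∈ []       _  = refl
  ∑-cong-∈ (x ∷ xs) eq = +-cong (eq (here ≡.refl)) (∑-cong-∈ xs (eq ∘ there))

  ∑-cong : ∀ (xs : List X) {f g : X → Carrier} → (∀ x → f x ≈ g x) → ∑ xs f ≈ ∑ xs g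
  ∑-cong xs eq = ∑-cong-∈ xs (λ {x} _ → eq x)

  ∑-zero : ∀ (xs : List X) {f : X → Carrier} → (∀ {x} → x ∈ xs → f x ≈ 0#) → ∑ xs f ≈ 0#
  ∑-zero []       _   = refl
  ∑-zero (x ∷ xs) f≈0 = trans (+-cong (f≈0 (here ≡.refl)) (∑-zero xs (f≈0 ∘ there))) (+-identityˡ 0#)

  ∑-distrib-+ : ∀ (xs : List X) (f g : X → Carrier) → ∑[ x ← xs ] (f x + g x) ≈ ∑ xs f + ∑ xs g
  ∑-distrib-+ []       f g = sym (+-identityˡ 0#)
  ∑-distrib-+ (x ∷ xs) f g =
    trans (+-congˡ (∑-distrib-+ xs f g)) (interchange (f x) (g x) (∑ xs f) (∑ xs g))

  *-distribˡ-∑ : ∀ a (xs : List X) (f : X → Carrier) → a * ∑ xs f ≈ ∑[ x ← xs ] (a * f x)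
  *-distribˡ-∑ a []       f = zeroʳ a
  *-distribˡ-∑ a (x ∷ xs) f = trans (distribˡ a (f x) (∑ xs f)) (+-congˡ (*-distribˡ-∑ a xs f))

  *-distribʳ-∑ : ∀ a (xs : List X) (f : X → Carrier) → ∑ xs f * a ≈ ∑[ x ← xs ] (f x * a)
  *-distribʳ-∑ a xs f = trans (*-comm _ a) (trans (*-distribˡ-∑ a xs f) (∑-cong xs (λ x → *-comm a (f x))))

  ∑-++ : ∀ (xs ys : List X) (f : X → Carrier) → ∑ (xs ++ ys) f ≈ ∑ xs f + ∑ ys f
  ∑-++ []       ys f = sym (+-identityˡ _)
  ∑-++ (x ∷ xs) ys f = trans (+-congˡ (∑-++ xs ys f)) (sym (+-assoc _ _ _))

  ∑-map : ∀ (h : X → Y) (xs : List X) (f : Y → Carrier) → ∑ (map h xs) f ≈ ∑ xs (f ∘ h)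
  ∑-map h []       f = refl
  ∑-map h (x ∷ xs) f = +-congˡ (∑-map h xs f)

  ∑-comm : ∀ (xs : List X) (ys : List Y) (f : X → Y → Carrier) →
    ∑[ x ← xs ] ∑[ y ← ys ] f x y ≈ ∑[ y ← ys ] ∑[ x ← xs ] f x y
  ∑-comm []       ys f = sym (∑-zero ys (λ _ → refl))
  ∑-comm (x ∷ xs) ys f = trans (+-congˡ (∑-comm xs ys f)) (sym (∑-distrib-+ ys (f x) (λ y → ∑[ x′ ← xs ] f x′ y)))

  ∑-cartesianProductWith : ∀ (_∙_ : X → Y → Z) (xs : List X) (ys : List Y) (f : Z → Carrier) →
    ∑ (cartesianProductWith _∙_ xs ys) f ≈ ∑[ x ← xs ] ∑[ y ← ys ] f (x ∙ y)
  ∑-cartesianProductWith _∙_ []       ys f = refl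
  ∑-cartesianProductWith _∙_ (x ∷ xs) ys f =
    trans (∑-++ (map (x ∙_) ys) _ f) (+-cong (∑-map (x ∙_) ys f) (∑-cartesianProductWith _∙_ xs ys f))

  ∏-∑-distrib : ∀ (xs : List X) (g : Y → X → Carrier) {n} (ys : Vec Y n) →
    ∏ (Vec.map (λ y → ∑ xs (g y)) ys) ≈ ∑[ w ← allVecs xs n ] ∏ (Vec.zipWith g ys w)
  ∏-∑-distrib xs g []               = sym (+-identityʳ 1#)
  ∏-∑-distrib xs g {suc n} (y ∷ ys) = begin
    ∑ xs (g y) * ∏ (Vec.map (λ y → ∑ xs (g y)) ys)
      ≈⟨ *-congˡ (∏-∑-distrib xs g ys) ⟩
    ∑ xs (g y) * ∑[ w ← allVecs xs n ] ∏ (Vec.zipWith g ys w)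
      ≈⟨ *-distribʳ-∑ _ xs (g y) ⟩
    ∑[ x ← xs ] (g y x * ∑[ w ← allVecs xs n ] ∏ (Vec.zipWith g ys w))
      ≈⟨ ∑-cong xs (λ x → *-distribˡ-∑ (g y x) (allVecs xs n) _) ⟩
    ∑[ x ← xs ] ∑[ w ← allVecs xs n ] ∏ (Vec.zipWith g (y ∷ ys) (x ∷ w))
      ≈⟨ ∑-cartesianProductWith _∷_ xs (allVecs xs n) (∏ ∘ Vec.zipWith g (y ∷ ys)) ⟨
    ∑[ w ← allVecs xs (suc n) ] ∏ (Vec.zipWith g (y ∷ ys) w) ∎

  *-when : ∀ {P : Set} (p? : Dec P) a r → a * when p? r ≈ when p? (a * r)
  *-when (yes _) a r = refl
  *-when (no _)  a r = zeroʳ a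

  when-cong : ∀ {P : Set} (p? : Dec P) {r s} → r ≈ s → when p? r ≈ when p? s
  when-cong (yes _) r≈s = r≈s
  when-cong (no _)  _   = refl

  when-when-implied : ∀ {P Q : Set} (p? : Dec P) (q? : Dec Q) → (Q → P) → ∀ r → when p? (when q? r) ≈ when q? r
  when-when-implied (yes _) q?      _   r = refl
  when-when-implied (no ¬p) (yes q) Q⇒P r = contradiction (Q⇒P q) ¬p
  when-when-implied (no _)  (no _)  _   r = refl

  module _ (_≟_ : DecidableEquality X) where

    open import Data.List.Membership.DecPropositional _≟_ using (_∈?_)

    ∑-when-∉ : ∀ (xs : List X) {k} → k ∉ xs → ∀ r → ∑[ x ← xs ] when (k ≟ x) r ≈ 0#
    ∑-when-∉ []       k∉ r = refl
    ∑-when-∉ (x ∷ xs) {k} k∉ r with k ≟ x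
    ... | yes ≡.refl = contradiction (here ≡.refl) k∉
    ... | no _       = trans (+-identityˡ _) (∑-when-∉ xs (k∉ ∘ there) r)

    ∑-when-∈ : ∀ {xs : List X} → Unique xs → ∀ {k} → k ∈ xs → ∀ r → ∑[ x ← xs ] when (k ≟ x) r ≈ r
    ∑-when-∈ {x ∷ xs} (x∉xs ∷ xs!) {k} k∈ r with k ≟ x | k∈
    ... | yes ≡.refl | _          =
      trans (+-congˡ (∑-when-∉ xs (λ k∈xs → All.lookup x∉xs k∈xs ≡.refl) r)) (+-identityʳ r)
    ... | no k≢x     | here k≡x   = contradiction k≡x k≢x
    ... | no _       | there k∈xs = trans (+-identityˡ _) (∑-when-∈ xs! k∈xs r)

    *-when-≟ : ∀ k e (f : X → Carrier) r → f e * when (k ≟ e) r ≈ when (k ≟ e) (f k * r)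
    *-when-≟ k e f r with k ≟ e
    ... | yes ≡.refl = refl
    ... | no _       = zeroʳ (f e)

    ∑-fibres : ∀ {ks : List X} → Unique ks → ∀ (ys : List Y) (key : Y → X) (f : Y → Carrier) →
      ∑[ k ← ks ] ∑[ y ← ys ] when (key y ≟ k) (f y) ≈ ∑[ y ← ys ] when (key y ∈? ks) (f y)
    ∑-fibres {ks = ks} ks! ys key f = trans (∑-comm ks ys _) (∑-cong ys fibre)
      where
      fibre : ∀ y → ∑[ k ← ks ] when (key y ≟ k) (f y) ≈ when (key y ∈? ks) (f y)
      fibre y with key y ∈? ks
      ... | yes key∈ks = ∑-when-∈ ks! key∈ks (f y)
      ... | no key∉ks  = ∑-when-∉ ks key∉ks (f y)

module NatSum where

  open import Data.Nat using (ℕ; suc; _≤_; z≤n; s≤s)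
  import Data.Nat.Properties as ℕ
  open import Data.List using (List; []; _∷_; filter; length)
  open import Data.List.Relation.Unary.Any using (Any; here; there; any?)
  open import Relation.Unary using (Decidable)
  open import Relation.Binary.PropositionalEquality using (_≡_; refl; cong)
  open import Relation.Nullary using (yes; no; contradiction)
  open Sum ℕ.+-*-commutativeSemiring using (∑; when)

  private
    variable
      A : Set

  ∑-mono-≤ : ∀ (xs : List A) {f g : A → ℕ} → (∀ x → f x ≤ g x) → ∑ xs f ≤ ∑ xs g
  ∑-mono-≤ []       f≤g = z≤n
  ∑-mono-≤ (x ∷ xs) f≤g = ℕ.+-mono-≤ (f≤g x) (∑-mono-≤ xs f≤g)

  module _ {P : A → Set} (P? : Decidable P) where

    length-filter≡∑ : ∀ xs → length (filter P? xs) ≡ ∑[ x ← xs ] when (P? x) 1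
    length-filter≡∑ []       = refl
    length-filter≡∑ (x ∷ xs) with P? x
    ... | yes _ = cong suc (length-filter≡∑ xs)
    ... | no _  = length-filter≡∑ xs

    when-any≤∑ : ∀ xs → when (any? P? xs) 1 ≤ ∑[ x ← xs ] when (P? x) 1
    when-any≤∑ xs with any? P? xs
    ... | no _    = z≤n
    ... | yes any = 1≤∑ any
      where
      1≤∑ : ∀ {ys} → Any P ys → 1 ≤ ∑[ y ← ys ] when (P? y) 1
      1≤∑ {y ∷ ys} (here py) with P? y
      ... | yes _ = s≤s z≤n
      ... | no ¬py = contradiction py ¬py
      1≤∑ {y ∷ ys} (there p) = ℕ.≤-trans (1≤∑ p) (ℕ.m≤n+m _ (when (P? y) 1))

module Field {q} (F : FiniteField q) where

  open import Level using (0ℓ)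
  open import Algebra.Bundles using (CommutativeRing)
  import Data.Nat as ℕ
  open import Data.Fin.Properties as Fin using ()
  open import Data.Product using (proj₁; proj₂)
  open import Function.Bundles using (Inverse)
  open import Relation.Binary.PropositionalEquality
  open import Relation.Binary.Definitions using (DecidableEquality)
  open import Relation.Nullary using (yes; no)
  open import Data.Vec using (Vec; []; _∷_; replicate; map)
  open import Data.Vec.Properties using (∷-injectiveˡ; ∷-injectiveʳ)
  open import Defs using (vadd; scale)

  open FiniteField F public

  commutativeRing : CommutativeRing 0ℓ 0ℓ
  commutativeRing = record { isCommutativeRing = isCommutativeRing }

  open CommutativeRing commutativeRing public
    using (+-assoc; +-comm; +-identityˡ; +-identityʳ; *-assoc; *-comm; *-identityˡ; *-identityʳ;
           zeroˡ; zeroʳ; -‿inverseˡ; -‿inverseʳ; commutativeSemiring)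
  open import Algebra.Properties.Ring (CommutativeRing.ring commutativeRing) public using (-‿distribˡ-*)
  open import Algebra.Properties.Group (CommutativeRing.+-group commutativeRing) public
    using () renaming (∙-cancelˡ to +-cancelˡ; ∙-cancelʳ to +-cancelʳ)

  open Inverse enumeration using (to; from; strictlyInverseˡ)

  infix 4 _≟_
  _≟_ : DecidableEquality Carrier
  a ≟ b with from a Fin.≟ from b
  ... | yes eq = yes (trans (sym (strictlyInverseˡ a)) (trans (cong to eq) (strictlyInverseˡ b)))
  ... | no neq = no (λ a≡b → neq (cong from a≡b))

  _⁻¹ : ∀ {a} → a ≢ 0# → Carrier
  a≢0 ⁻¹ = proj₁ (inverse _ a≢0)

  *-inverseʳ : ∀ {a} (a≢0 : a ≢ 0#) → a * a≢0 ⁻¹ ≡ 1#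
  *-inverseʳ a≢0 = proj₂ (inverse _ a≢0)

  *-cancelˡ : ∀ {a} → a ≢ 0# → ∀ b c → a * b ≡ a * c → b ≡ c
  *-cancelˡ {a} a≢0 b c eq = trans (sym (inverse-cancel b)) (trans (cong (a≢0 ⁻¹ *_) eq) (inverse-cancel c))
    where
    inverse-cancel : ∀ z → a≢0 ⁻¹ * (a * z) ≡ z
    inverse-cancel z = trans (sym (*-assoc _ a z))
      (trans (cong (_* z) (trans (*-comm _ a) (*-inverseʳ a≢0))) (*-identityˡ z))

  vadd-cancelˡ : ∀ {n} (u v w : Vec Carrier n) → vadd F u v ≡ vadd F u w → v ≡ w
  vadd-cancelˡ []      []      []      _  = refl
  vadd-cancelˡ (a ∷ u) (b ∷ v) (c ∷ w) eq =
    cong₂ _∷_ (+-cancelˡ a b c (∷-injectiveˡ eq)) (vadd-cancelˡ u v w (∷-injectiveʳ eq))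

  vadd-cancelʳ : ∀ {n} (u v w : Vec Carrier n) → vadd F v u ≡ vadd F w u → v ≡ w
  vadd-cancelʳ []      []      []      _  = refl
  vadd-cancelʳ (a ∷ u) (b ∷ v) (c ∷ w) eq =
    cong₂ _∷_ (+-cancelʳ a b c (∷-injectiveˡ eq)) (vadd-cancelʳ u v w (∷-injectiveʳ eq))

  scale-injective : ∀ {n a} → a ≢ 0# → (u v : Vec Carrier n) → scale F a u ≡ scale F a v → u ≡ v
  scale-injective a≢0 []      []      _  = refl
  scale-injective a≢0 (b ∷ u) (c ∷ v) eq =
    cong₂ _∷_ (*-cancelˡ a≢0 b c (∷-injectiveˡ eq)) (scale-injective a≢0 u v (∷-injectiveʳ eq))

  vadd-neg≡0 : ∀ {n} (u v w : Vec Carrier n) → vadd F u (vadd F v (map -_ w)) ≡ replicate n 0# → vadd F u v ≡ w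
  vadd-neg≡0 []      []      []      _  = refl
  vadd-neg≡0 (a ∷ u) (b ∷ v) (c ∷ w) eq = cong₂ _∷_ a+b≡c (vadd-neg≡0 u v w (∷-injectiveʳ eq))
    where
    a+b≡c : a + b ≡ c
    a+b≡c = +-cancelʳ (- c) (a + b) c
      (trans (trans (+-assoc a b (- c)) (∷-injectiveˡ eq)) (sym (-‿inverseʳ c)))

  vadd-neg-vadd≡0 : ∀ {n} (u v : Vec Carrier n) → vadd F u (vadd F v (map -_ (vadd F u v))) ≡ replicate n 0#
  vadd-neg-vadd≡0 []      []      = refl
  vadd-neg-vadd≡0 (a ∷ u) (b ∷ v) =
    cong₂ _∷_ (trans (sym (+-assoc a b (- (a + b)))) (-‿inverseʳ (a + b))) (vadd-neg-vadd≡0 u v)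

  1≤q : 1 ℕ.≤ q
  1≤q = ℕ.>-nonZero⁻¹ q {{Fin.nonZeroIndex (from 0#)}}

module SliceRank {q} (F : FiniteField q) (A : Set) where

  open import Data.Nat using (ℕ; zero; suc; _≤_; z≤n; s≤s)
  open import Data.Nat.Properties using (m≤n⇒m≤1+n; suc-injective)
  open import Data.List using (List; []; _∷_; map; length)
  open import Data.List.Properties using (length-map)
  open import Data.List.Membership.Propositional using (_∈_; find)
  open import Data.List.Relation.Unary.Any using (here)
  open import Data.List.Relation.Unary.All as All using (all?)
  open import Data.List.Relation.Unary.All.Properties using (¬All⇒Any¬)
  open import Data.List.Relation.Unary.Unique.Propositional using (Unique)
  open import Data.List.Relation.Binary.Subset.Propositional using (_⊆_)
  open import Data.Product using (_×_; _,_; proj₁; proj₂)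
  open import Function using (id; _∘_)
  open import Relation.Binary.PropositionalEquality
    using (_≡_; _≢_; refl; sym; trans; cong; cong₂; subst; module ≡-Reasoning)
  open import Relation.Nullary using (¬_; yes; no; contradiction)
  open import Relation.Binary.Definitions using (DecidableEquality)
  open Field F
  open Sum commutativeSemiring using (∑; *-distribˡ-∑; ∑-distrib-+; ∑-map; ∑-cong)
  open Lists using (without; length-without; ∈-without⁻; without⁺)
  open import Algebra.Solver.Ring.NaturalCoefficients.Default commutativeSemiring
    using (solve; _:=_; _:+_; _:*_; con)

  Tensor : Set
  Tensor = A → A → A → Carrier

  data Slice : Set where
    slice₁ slice₂ slice₃ : (A → Carrier) → (A → A → Carrier) → Slice

  ⟦_⟧ : Slice → Tensor
  ⟦ slice₁ f g ⟧ a b c = f a * g b c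
  ⟦ slice₂ f g ⟧ a b c = f b * g a c
  ⟦ slice₃ f g ⟧ a b c = f c * g a b

  ∑⟦_⟧ : List Slice → Tensor
  ∑⟦ ss ⟧ a b c = ∑[ s ← ss ] ⟦ s ⟧ a b c

  rotate : Slice → Slice
  rotate (slice₁ f g) = slice₂ f (λ a c → g c a)
  rotate (slice₂ f g) = slice₃ f (λ a b → g b a)
  rotate (slice₃ f g) = slice₁ f g

  ∑⟦map-rotate⟧ : ∀ ss a b c → ∑⟦ map rotate ss ⟧ a b c ≡ ∑⟦ ss ⟧ b c a
  ∑⟦map-rotate⟧ ss a b c = trans (∑-map rotate ss _) (∑-cong ss (λ s → ⟦rotate⟧ s))
    where
    ⟦rotate⟧ : ∀ s → ⟦ rotate s ⟧ a b c ≡ ⟦ s ⟧ b c a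
    ⟦rotate⟧ (slice₁ _ _) = refl
    ⟦rotate⟧ (slice₂ _ _) = refl
    ⟦rotate⟧ (slice₃ _ _) = refl

  record DiagonalOn (S : List A) (T : Tensor) : Set where
    field
      off-diagonal : ∀ {a b c} → a ∈ S → b ∈ S → c ∈ S → ¬ (a ≡ b × b ≡ c) → T a b c ≡ 0#
      diagonal≢0   : ∀ {a} → a ∈ S → T a a a ≢ 0#

  open DiagonalOn

  DiagonalOn-rotate : ∀ {S T} → DiagonalOn S T → DiagonalOn S (λ a b c → T b c a)
  DiagonalOn-rotate D .off-diagonal a∈ b∈ c∈ ¬a≡b≡c =
    D .off-diagonal b∈ c∈ a∈ (λ (b≡c , c≡a) → ¬a≡b≡c (trans (sym c≡a) (sym b≡c) , b≡c))
  DiagonalOn-rotate D .diagonal≢0 = D .diagonal≢0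

  DiagonalOn-transfer : ∀ {S S′ T T′} → S′ ⊆ S →
    (∀ {a b c} → a ∈ S′ → b ∈ S′ → c ∈ S′ → T′ a b c ≡ T a b c) →
    DiagonalOn S T → DiagonalOn S′ T′
  DiagonalOn-transfer S′⊆S T′≡T D .off-diagonal a∈ b∈ c∈ ¬a≡b≡c =
    trans (T′≡T a∈ b∈ c∈) (D .off-diagonal (S′⊆S a∈) (S′⊆S b∈) (S′⊆S c∈) ¬a≡b≡c)
  DiagonalOn-transfer S′⊆S T′≡T D .diagonal≢0 a∈ T′aaa≡0 =
    D .diagonal≢0 (S′⊆S a∈) (trans (sym (T′≡T a∈ a∈ a∈)) T′aaa≡0)

  DiagonalOn-map-rotate : ∀ {S} ss → DiagonalOn S ∑⟦ ss ⟧ → DiagonalOn S ∑⟦ map rotate ss ⟧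
  DiagonalOn-map-rotate ss D =
    DiagonalOn-transfer id (λ {a} {b} {c} _ _ _ → ∑⟦map-rotate⟧ ss a b c) (DiagonalOn-rotate D)

  -- Adding κ a times its a₀-section to every other slice cancels slice₁ f g, and changes nothing
  -- on S ∖ {a₀}, where the a₀-section of a diagonal tensor vanishes.
  module Eliminate (f : A → Carrier) (g : A → A → Carrier) {a₀ : A} (fa₀≢0 : f a₀ ≢ 0#) where

    ν : Carrier
    ν = - (fa₀≢0 ⁻¹)

    κ : A → Carrier
    κ a = f a * ν

    absorb : Slice → Slice
    absorb (slice₁ h k) = slice₁ (λ a → h a + κ a * h a₀) k
    absorb (slice₂ h k) = slice₂ h (λ a c → k a c + κ a * k a₀ c)
    absorb (slice₃ h k) = slice₃ h (λ a b → k a b + κ a * k a₀ b)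

    private
      distribʳ-scaled : ∀ x y z w → (x + z * y) * w ≡ x * w + z * (y * w)
      distribʳ-scaled = solve 4 (λ x y z w → (x :+ z :* y) :* w := x :* w :+ z :* (y :* w)) refl
      distribˡ-scaled : ∀ x y z w → x * (y + z * w) ≡ x * y + z * (x * w)
      distribˡ-scaled = solve 4 (λ x y z w → x :* (y :+ z :* w) := x :* y :+ z :* (x :* w)) refl
      interchange-scaled : ∀ x y z w u → (x + y) + z * (w + u) ≡ (x + z * w) + (y + z * u)
      interchange-scaled = solve 5 (λ x y z w u → (x :+ y) :+ z :* (w :+ u) := (x :+ z :* w) :+ (y :+ z :* u)) refl
      factor : ∀ x y z w → x * y + (x * z) * (w * y) ≡ (x * y) * (1# + z * w)
      factor = solve 4 (λ x y z w → x :* y :+ (x :* z) :* (w :* y) := (x :* y) :* (con 1 :+ z :* w)) refl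

    ⟦absorb⟧ : ∀ s a b c → ⟦ absorb s ⟧ a b c ≡ ⟦ s ⟧ a b c + κ a * ⟦ s ⟧ a₀ b c
    ⟦absorb⟧ (slice₁ h k) a b c = distribʳ-scaled (h a) (h a₀) (κ a) (k b c)
    ⟦absorb⟧ (slice₂ h k) a b c = distribˡ-scaled (h b) (k a c) (κ a) (k a₀ c)
    ⟦absorb⟧ (slice₃ h k) a b c = distribˡ-scaled (h c) (k a b) (κ a) (k a₀ b)

    ν*fa₀≡-1 : ν * f a₀ ≡ - 1#
    ν*fa₀≡-1 = trans (sym (-‿distribˡ-* _ (f a₀))) (cong -_ (trans (*-comm _ (f a₀)) (*-inverseʳ fa₀≢0)))

    slice₁-cancelled : ∀ a b c → ⟦ slice₁ f g ⟧ a b c + κ a * ⟦ slice₁ f g ⟧ a₀ b c ≡ 0#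
    slice₁-cancelled a b c = begin
      f a * g b c + (f a * ν) * (f a₀ * g b c) ≡⟨ factor (f a) (g b c) ν (f a₀) ⟩
      (f a * g b c) * (1# + ν * f a₀)          ≡⟨ cong (λ z → (f a * g b c) * (1# + z)) ν*fa₀≡-1 ⟩
      (f a * g b c) * (1# + - 1#)              ≡⟨ cong ((f a * g b c) *_) (-‿inverseʳ 1#) ⟩
      (f a * g b c) * 0#                       ≡⟨ zeroʳ _ ⟩
      0#                                       ∎
      where open ≡-Reasoning

    ∑⟦map-absorb⟧ : ∀ ss a b c →
      ∑⟦ map absorb ss ⟧ a b c ≡ ∑⟦ slice₁ f g ∷ ss ⟧ a b c + κ a * ∑⟦ slice₁ f g ∷ ss ⟧ a₀ b c
    ∑⟦map-absorb⟧ ss a b c = sym (begin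
      (⟦ slice₁ f g ⟧ a b c + ∑⟦ ss ⟧ a b c) + κ a * (⟦ slice₁ f g ⟧ a₀ b c + ∑⟦ ss ⟧ a₀ b c)
        ≡⟨ interchange-scaled _ _ _ _ _ ⟩
      (⟦ slice₁ f g ⟧ a b c + κ a * ⟦ slice₁ f g ⟧ a₀ b c) + (∑⟦ ss ⟧ a b c + κ a * ∑⟦ ss ⟧ a₀ b c)
        ≡⟨ cong₂ _+_ (slice₁-cancelled a b c) (sym ∑⟦ss⟧-absorbed) ⟩
      0# + ∑⟦ map absorb ss ⟧ a b c
        ≡⟨ +-identityˡ _ ⟩
      ∑⟦ map absorb ss ⟧ a b c ∎)
      where
      open ≡-Reasoning
      ∑⟦ss⟧-absorbed : ∑⟦ map absorb ss ⟧ a b c ≡ ∑⟦ ss ⟧ a b c + κ a * ∑⟦ ss ⟧ a₀ b c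
      ∑⟦ss⟧-absorbed = begin
        ∑⟦ map absorb ss ⟧ a b c                                  ≡⟨ ∑-map absorb ss _ ⟩
        ∑[ s ← ss ] ⟦ absorb s ⟧ a b c                            ≡⟨ ∑-cong ss (λ s → ⟦absorb⟧ s a b c) ⟩
        ∑[ s ← ss ] (⟦ s ⟧ a b c + κ a * ⟦ s ⟧ a₀ b c)            ≡⟨ ∑-distrib-+ ss _ _ ⟩
        ∑⟦ ss ⟧ a b c + ∑[ s ← ss ] (κ a * ⟦ s ⟧ a₀ b c)          ≡⟨ cong (∑⟦ ss ⟧ a b c +_) (sym (*-distribˡ-∑ (κ a) ss _)) ⟩
        ∑⟦ ss ⟧ a b c + κ a * ∑⟦ ss ⟧ a₀ b c                      ∎

  SliceBound : ℕ → Set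
  SliceBound n = ∀ (ss : List Slice) {S} → length ss ≡ n → Unique S → DiagonalOn S ∑⟦ ss ⟧ → length S ≤ n

  module _ (_≟ᴬ_ : DecidableEquality A) where

    eliminate-slice₁ : ∀ {n} → SliceBound n → ∀ f g ss {S} → length ss ≡ n → Unique S →
      DiagonalOn S ∑⟦ slice₁ f g ∷ ss ⟧ → length S ≤ suc n
    eliminate-slice₁ {n} bound f g ss {S} ∣ss∣≡n S! D with all? (λ a → f a ≟ 0#) S
    ... | yes f≡0 = m≤n⇒m≤1+n (bound ss ∣ss∣≡n S! (DiagonalOn-transfer id slice₁-vanishes D))
      where
      slice₁-vanishes : ∀ {a b c} → a ∈ S → b ∈ S → c ∈ S → ∑⟦ ss ⟧ a b c ≡ ∑⟦ slice₁ f g ∷ ss ⟧ a b c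
      slice₁-vanishes {a} {b} {c} a∈S _ _ = sym (begin
        f a * g b c + ∑⟦ ss ⟧ a b c ≡⟨ cong (λ z → z * g b c + ∑⟦ ss ⟧ a b c) (All.lookup f≡0 a∈S) ⟩
        0# * g b c + ∑⟦ ss ⟧ a b c  ≡⟨ cong (_+ ∑⟦ ss ⟧ a b c) (zeroˡ _) ⟩
        0# + ∑⟦ ss ⟧ a b c          ≡⟨ +-identityˡ _ ⟩
        ∑⟦ ss ⟧ a b c               ∎)
        where open ≡-Reasoning
    ... | no ¬f≡0 with find (¬All⇒Any¬ (λ a → f a ≟ 0#) S ¬f≡0)
    ...   | a₀ , a₀∈S , fa₀≢0 =
      subst (_≤ suc n) (sym (length-without _≟ᴬ_ S! a₀∈S))
        (s≤s (bound (map absorb ss) (trans (length-map absorb ss) ∣ss∣≡n) (without⁺ _≟ᴬ_ S!)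
          (DiagonalOn-transfer (proj₁ ∘ ∈S′⁻) absorbed-agrees D)))
      where
      open Eliminate f g fa₀≢0
      S′ : List A
      S′ = without _≟ᴬ_ a₀ S
      ∈S′⁻ : ∀ {b} → b ∈ S′ → b ∈ S × b ≢ a₀
      ∈S′⁻ = ∈-without⁻ _≟ᴬ_ {a₀} {xs = S}
      absorbed-agrees : ∀ {a b c} → a ∈ S′ → b ∈ S′ → c ∈ S′ →
        ∑⟦ map absorb ss ⟧ a b c ≡ ∑⟦ slice₁ f g ∷ ss ⟧ a b c
      absorbed-agrees {a} {b} {c} _ b∈S′ c∈S′ = begin
        ∑⟦ map absorb ss ⟧ a b c
          ≡⟨ ∑⟦map-absorb⟧ ss a b c ⟩
        ∑⟦ slice₁ f g ∷ ss ⟧ a b c + κ a * ∑⟦ slice₁ f g ∷ ss ⟧ a₀ b c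
          ≡⟨ cong (λ z → ∑⟦ slice₁ f g ∷ ss ⟧ a b c + κ a * z) (D .off-diagonal a₀∈S b∈S c∈S a₀≢b) ⟩
        ∑⟦ slice₁ f g ∷ ss ⟧ a b c + κ a * 0#
          ≡⟨ trans (cong (∑⟦ slice₁ f g ∷ ss ⟧ a b c +_) (zeroʳ _)) (+-identityʳ _) ⟩
        ∑⟦ slice₁ f g ∷ ss ⟧ a b c ∎
        where
        open ≡-Reasoning
        b∈S : b ∈ S
        b∈S = proj₁ (∈S′⁻ b∈S′)
        c∈S : c ∈ S
        c∈S = proj₁ (∈S′⁻ c∈S′)
        a₀≢b : ¬ (a₀ ≡ b × b ≡ c)
        a₀≢b (a₀≡b , _) = proj₂ (∈S′⁻ b∈S′) (sym a₀≡b)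

    diagonal⇒length≤slices : ∀ n → SliceBound n
    diagonal⇒length≤slices zero    []                 {[]}    _ _ _ = z≤n
    diagonal⇒length≤slices zero    []                 {a ∷ S} _ _ D = contradiction refl (D .diagonal≢0 (here refl))
    diagonal⇒length≤slices (suc n) (slice₁ f g ∷ ss) ∣ss∣≡n S! D =
      eliminate-slice₁ (diagonal⇒length≤slices n) f g ss (suc-injective ∣ss∣≡n) S! D
    diagonal⇒length≤slices (suc n) (slice₂ f g ∷ ss) ∣ss∣≡n S! D =
      eliminate-slice₁ (diagonal⇒length≤slices n) f _ (map rotate (map rotate ss))
        (trans (length-map rotate (map rotate ss)) (trans (length-map rotate ss) (suc-injective ∣ss∣≡n))) S!
        (DiagonalOn-map-rotate (map rotate (slice₂ f g ∷ ss)) (DiagonalOn-map-rotate (slice₂ f g ∷ ss) D))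
    diagonal⇒length≤slices (suc n) (slice₃ f g ∷ ss) ∣ss∣≡n S! D =
      eliminate-slice₁ (diagonal⇒length≤slices n) f g (map rotate ss)
        (trans (length-map rotate ss) (suc-injective ∣ss∣≡n)) S!
        (DiagonalOn-map-rotate (slice₃ f g ∷ ss) D)

module Small where

  open import Data.Nat using (ℕ; _*_; _∸_; _≤_; _<_; _≤?_)
  open import Data.List using (List; filter; downFrom)
  open import Data.List.Membership.Propositional using (_∈_)
  open import Data.List.Membership.Propositional.Properties using (∈-filter⁺; ∈-downFrom⁺)
  open import Data.List.Relation.Unary.Unique.Propositional using (Unique)
  open import Data.List.Relation.Unary.Unique.Propositional.Properties using (filter⁺; downFrom⁺)
  open import Data.Vec as Vec using (Vec)
  import Data.Vec.Relation.Unary.All as VecAll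
  open import Relation.Unary using (Decidable)
  open Lists using (allVecs; ∈-allVecs⁺; allVecs⁺)

  small : (q N : ℕ) → Vec ℕ N → Set
  small q N e = 3 * Vec.sum e ≤ N * (q ∸ 1)

  small? : ∀ q N → Decidable (small q N)
  small? q N e = 3 * Vec.sum e ≤? N * (q ∸ 1)

  smallVectors : (q N : ℕ) → List (Vec ℕ N)
  smallVectors q N = filter (small? q N) (allVecs (downFrom q) N)

  smallVectors⁺ : ∀ q N → Unique (smallVectors q N)
  smallVectors⁺ q N = filter⁺ (small? q N) (allVecs⁺ N (downFrom⁺ q))

  ∈-smallVectors⁺ : ∀ {q N} {e : Vec ℕ N} → VecAll.All (_< q) e → small q N e → e ∈ smallVectors q N
  ∈-smallVectors⁺ {q} {N} e<q = ∈-filter⁺ (small? q N) (∈-allVecs⁺ (VecAll.map ∈-downFrom⁺ e<q))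

module Tricoloured {q} (F : FiniteField q) where

  open import Data.Nat as ℕ using (ℕ; zero; suc; _∸_; _≤_; _<_; z≤n; s≤s)
  import Data.Nat.Properties as ℕ
  open import Data.Nat.Tactic.RingSolver using (solve-∀)
  open import Data.List as List using (List; []; _∷_; map; length; filter; allFin; cartesianProductWith)
  import Data.List.Properties as List
  open import Data.List.Membership.Propositional using (_∈_)
  open import Data.List.Membership.Propositional.Properties using (∈-map⁺; ∈-filter⁺; ∈-allFin)
  open import Data.List.Relation.Unary.Any as Any using (here; there)
  import Data.List.Relation.Unary.All as All
  open import Data.List.Relation.Unary.Unique.Propositional using (Unique; []; _∷_)
  open import Data.Vec as Vec using (Vec; []; _∷_)
  import Data.Vec.Properties as Vec
  open import Data.Vec.Relation.Unary.All as VecAll using ([]; _∷_)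
  open import Data.Product using (_×_; _,_; proj₁; proj₂)
  open import Function using (id)
  open import Function.Bundles using (Inverse)
  open import Relation.Binary.PropositionalEquality
  open import Relation.Binary.Definitions using (DecidableEquality)
  open import Relation.Nullary using (¬?; yes; no; contradiction)
  open import Algebra.Bundles using (CommutativeSemiring)
  open Field F
  open Sum commutativeSemiring
  open Lists using (allVecs; ∈-allVecs⁻; length-cartesianProductWith)
  open Small using (small; small?; smallVectors; smallVectors⁺; ∈-smallVectors⁺)

  open import Algebra.Definitions.RawSemiring (CommutativeSemiring.rawSemiring commutativeSemiring) using (_^_)
  open import Algebra.Solver.Ring.NaturalCoefficients.Default commutativeSemiring
    using (solve; _:=_; _:+_; _:*_; con)

  elements : List Carrier
  elements = map (Inverse.to enumeration) (allFin q)

  ∈-elements : ∀ a → a ∈ elements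
  ∈-elements a = subst (_∈ elements) (Inverse.strictlyInverseˡ enumeration a) (∈-map⁺ _ (∈-allFin _))

  nonzeros : List Carrier
  nonzeros = filter (λ a → ¬? (a ≟ 0#)) elements

  length-nonzeros : length nonzeros < q
  length-nonzeros = subst (length nonzeros <_) length-elements
    (List.filter-notAll _ elements (Any.map (λ { refl 0≢0 → 0≢0 refl }) (∈-elements 0#)))
    where
    length-elements : length elements ≡ q
    length-elements = trans (List.length-map _ (allFin q)) (List.length-tabulate _)

  negInv : Carrier → Carrier
  negInv a with a ≟ 0#
  ... | yes _   = 0#
  ... | no a≢0 = - (a≢0 ⁻¹)

  1+negInv*a≡0 : ∀ {a} → a ≢ 0# → 1# + negInv a * a ≡ 0#
  1+negInv*a≡0 {a} a≢0 with a ≟ 0#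
  ... | yes a≡0 = contradiction a≡0 a≢0
  ... | no a≢0′ = begin
    1# + - (a≢0′ ⁻¹) * a ≡⟨ cong (1# +_) (sym (-‿distribˡ-* _ a)) ⟩
    1# + - (a≢0′ ⁻¹ * a) ≡⟨ cong (λ z → 1# + - z) (trans (*-comm _ a) (*-inverseʳ a≢0′)) ⟩
    1# + - 1#            ≡⟨ -‿inverseʳ 1# ⟩
    0#                   ∎
    where open ≡-Reasoning

  δ-degree : ℕ
  δ-degree = length (map negInv nonzeros)

  δ-degree<q : δ-degree < q
  δ-degree<q = subst (_< q) (sym (List.length-map negInv nonzeros)) length-nonzeros

  δ-degree≤q∸1 : δ-degree ≤ q ∸ 1
  δ-degree≤q∸1 = <⇒≤∸1 δ-degree<q
    where
    <⇒≤∸1 : ∀ {i j} → i < j → i ≤ j ∸ 1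
    <⇒≤∸1 (s≤s i≤j) = i≤j

  coefficients : Vec Carrier δ-degree
  coefficients = Vec.fromList (map negInv nonzeros)

  -- δ s = ∏_{a ≠ 0} (1 - s / a) is 1 at s = 0 and 0 elsewhere, with degree below q; it stands in
  -- for 1 - s^(q-1), which would need Fermat's little theorem.
  δ : Carrier → Carrier
  δ s = ∏ (Vec.map (λ μ → 1# + μ * s) coefficients)

  δ-0 : δ 0# ≡ 1#
  δ-0 = ∏-ones coefficients
    where
    ∏-ones : ∀ {k} (μs : Vec Carrier k) → ∏ (Vec.map (λ μ → 1# + μ * 0#) μs) ≡ 1#
    ∏-ones []       = refl
    ∏-ones (μ ∷ μs) = trans (cong₂ _*_ (trans (cong (1# +_) (zeroʳ μ)) (+-identityʳ 1#)) (∏-ones μs)) (*-identityˡ 1#)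

  δ-≢0 : ∀ {s} → s ≢ 0# → δ s ≡ 0#
  δ-≢0 {s} s≢0 = ∏-vanishes (map negInv nonzeros) (∈-map⁺ negInv (∈-filter⁺ _ (∈-elements s) s≢0))
    (1+negInv*a≡0 s≢0)
    where
    ∏-vanishes : ∀ μs {μ} → μ ∈ μs → 1# + μ * s ≡ 0# → ∏ (Vec.map (λ μ → 1# + μ * s) (Vec.fromList μs)) ≡ 0#
    ∏-vanishes (μ ∷ μs) (here refl) 1+μs≡0 =
      trans (cong (_* ∏ (Vec.map (λ μ → 1# + μ * s) (Vec.fromList μs))) 1+μs≡0) (zeroˡ _)
    ∏-vanishes (μ′ ∷ μs) (there μ∈μs) 1+μs≡0 = trans (cong (_ *_) (∏-vanishes μs μ∈μs 1+μs≡0)) (zeroʳ _)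

  data Colour : Set where
    c₁ c₂ c₃ : Colour

  -- Expanding 1 + μ (x + y + z) chooses one of its four terms; a word of picks chooses one
  -- term in every factor of δ (x + y + z), and a grid does so for every coordinate of Δ.
  data Pick : Set where
    skip : Pick
    pick : Colour → Pick

  picks : List Pick
  picks = skip ∷ pick c₁ ∷ pick c₂ ∷ pick c₃ ∷ []

  count : Colour → ∀ {k} → Vec Pick k → ℕ
  count _  []            = 0
  count c₁ (pick c₁ ∷ w) = suc (count c₁ w)
  count c₂ (pick c₂ ∷ w) = suc (count c₂ w)
  count c₃ (pick c₃ ∷ w) = suc (count c₃ w)
  count c  (_ ∷ w)       = count c w

  degree : ∀ {k} → Vec Pick k → ℕ
  degree w = count c₁ w ℕ.+ (count c₂ w ℕ.+ count c₃ w)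

  degree≤length : ∀ {k} (w : Vec Pick k) → degree w ≤ k
  degree≤length []            = z≤n
  degree≤length (skip ∷ w)    = ℕ.m≤n⇒m≤1+n (degree≤length w)
  degree≤length (pick c₁ ∷ w) = s≤s (degree≤length w)
  degree≤length {suc k} (pick c₂ ∷ w) = subst (_≤ suc k) (sym (ℕ.+-suc (count c₁ w) _)) (s≤s (degree≤length w))
  degree≤length {suc k} (pick c₃ ∷ w) =
    subst (_≤ suc k) (sym (trans (cong (count c₁ w ℕ.+_) (ℕ.+-suc (count c₂ w) _)) (ℕ.+-suc (count c₁ w) _)))
      (s≤s (degree≤length w))

  pickTerm : Carrier → Carrier → Carrier → Carrier → Pick → Carrier
  pickTerm x y z μ skip      = 1#
  pickTerm x y z μ (pick c₁) = μ * x
  pickTerm x y z μ (pick c₂) = μ * y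
  pickTerm x y z μ (pick c₃) = μ * z

  ∑-pickTerm : ∀ x y z μ → ∑ picks (pickTerm x y z μ) ≡ 1# + μ * (x + (y + z))
  ∑-pickTerm = solve 4 (λ x y z μ → con 1 :+ (μ :* x :+ (μ :* y :+ (μ :* z :+ con 0))) := con 1 :+ μ :* (x :+ (y :+ z))) refl

  coefficient : ∀ {k} → Vec Carrier k → Vec Pick k → Carrier
  coefficient []       []           = 1#
  coefficient (μ ∷ μs) (skip ∷ w)   = coefficient μs w
  coefficient (μ ∷ μs) (pick _ ∷ w) = μ * coefficient μs w

  monomial₃ : ∀ {k} → Carrier → Carrier → Carrier → Vec Pick k → Carrier
  monomial₃ x y z w = x ^ count c₁ w * (y ^ count c₂ w * z ^ count c₃ w)

  ∏-pickTerm : ∀ {k} (μs : Vec Carrier k) (w : Vec Pick k) x y z →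
    ∏ (Vec.zipWith (pickTerm x y z) μs w) ≡ coefficient μs w * monomial₃ x y z w
  ∏-pickTerm []       []            x y z = sym (trans (*-identityˡ _) (trans (*-identityˡ _) (*-identityˡ _)))
  ∏-pickTerm (μ ∷ μs) (skip ∷ w)    x y z = trans (*-identityˡ _) (∏-pickTerm μs w x y z)
  ∏-pickTerm (μ ∷ μs) (pick c₁ ∷ w) x y z = trans (cong ((μ * x) *_) (∏-pickTerm μs w x y z)) (absorb₁ μ x _ _ _ _)
    where
    absorb₁ : ∀ μ x c X Y Z → (μ * x) * (c * (X * (Y * Z))) ≡ (μ * c) * ((x * X) * (Y * Z))
    absorb₁ = solve 6 (λ μ x c X Y Z → (μ :* x) :* (c :* (X :* (Y :* Z))) := (μ :* c) :* ((x :* X) :* (Y :* Z))) refl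
  ∏-pickTerm (μ ∷ μs) (pick c₂ ∷ w) x y z = trans (cong ((μ * y) *_) (∏-pickTerm μs w x y z)) (absorb₂ μ y _ _ _ _)
    where
    absorb₂ : ∀ μ y c X Y Z → (μ * y) * (c * (X * (Y * Z))) ≡ (μ * c) * (X * ((y * Y) * Z))
    absorb₂ = solve 6 (λ μ y c X Y Z → (μ :* y) :* (c :* (X :* (Y :* Z))) := (μ :* c) :* (X :* ((y :* Y) :* Z))) refl
  ∏-pickTerm (μ ∷ μs) (pick c₃ ∷ w) x y z = trans (cong ((μ * z) *_) (∏-pickTerm μs w x y z)) (absorb₃ μ z _ _ _ _)
    where
    absorb₃ : ∀ μ z c X Y Z → (μ * z) * (c * (X * (Y * Z))) ≡ (μ * c) * (X * (Y * (z * Z)))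
    absorb₃ = solve 6 (λ μ z c X Y Z → (μ :* z) :* (c :* (X :* (Y :* Z))) := (μ :* c) :* (X :* (Y :* (z :* Z)))) refl

  words : List (Vec Pick δ-degree)
  words = allVecs picks δ-degree

  δ-expand : ∀ x y z → δ (x + (y + z)) ≡ ∑[ w ← words ] (coefficient coefficients w * monomial₃ x y z w)
  δ-expand x y z = begin
    ∏ (Vec.map (λ μ → 1# + μ * (x + (y + z))) coefficients)
      ≡⟨ cong ∏ (Vec.map-cong (λ μ → sym (∑-pickTerm x y z μ)) coefficients) ⟩
    ∏ (Vec.map (λ μ → ∑ picks (pickTerm x y z μ)) coefficients)
      ≡⟨ ∏-∑-distrib picks (pickTerm x y z) coefficients ⟩
    ∑[ w ← words ] ∏ (Vec.zipWith (pickTerm x y z) coefficients w)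
      ≡⟨ ∑-cong words (λ w → ∏-pickTerm coefficients w x y z) ⟩
    ∑[ w ← words ] (coefficient coefficients w * monomial₃ x y z w) ∎
    where open ≡-Reasoning

  monomial : ∀ {N} → Vec Carrier N → Vec ℕ N → Carrier
  monomial u e = ∏ (Vec.zipWith _^_ u e)

  Δ : ∀ {N} → Vec Carrier N → Carrier
  Δ s = ∏ (Vec.map δ s)

  Δ-zeros : ∀ N → Δ (Vec.replicate N 0#) ≡ 1#
  Δ-zeros zero    = refl
  Δ-zeros (suc N) = trans (cong₂ _*_ δ-0 (Δ-zeros N)) (*-identityˡ 1#)

  Δ-≢zeros : ∀ {N} (s : Vec Carrier N) → s ≢ Vec.replicate N 0# → Δ s ≡ 0#
  Δ-≢zeros []      s≢0 = contradiction refl s≢0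
  Δ-≢zeros (a ∷ s) s≢0 with a ≟ 0#
  ... | no a≢0  = trans (cong (_* Δ s) (δ-≢0 a≢0)) (zeroˡ _)
  ... | yes a≡0 = trans (cong (δ a *_) (Δ-≢zeros s (λ s≡0 → s≢0 (cong₂ _∷_ a≡0 s≡0)))) (zeroʳ _)

  Grid : ℕ → Set
  Grid N = Vec (Vec Pick δ-degree) N

  exponents : Colour → ∀ {N} → Grid N → Vec ℕ N
  exponents c = Vec.map (count c)

  gridCoefficient : ∀ {N} → Grid N → Carrier
  gridCoefficient Ω = ∏ (Vec.map (coefficient coefficients) Ω)

  gridTerm : ∀ {N} → Vec Carrier N → Vec Carrier N → Vec Carrier N → Grid N → Carrier
  gridTerm u v w Ω = gridCoefficient Ω *
    (monomial u (exponents c₁ Ω) * (monomial v (exponents c₂ Ω) * monomial w (exponents c₃ Ω)))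

  Δ-expand : ∀ {N} (u v w : Vec Carrier N) → Δ (vadd F u (vadd F v w)) ≡ ∑[ Ω ← allVecs words N ] gridTerm u v w Ω
  Δ-expand [] [] [] = sym (trans (+-identityʳ _) (trans (*-identityˡ _) (trans (*-identityˡ _) (*-identityˡ _))))
  Δ-expand {suc N} (a ∷ u) (b ∷ v) (c ∷ w) = begin
    δ (a + (b + c)) * Δ (vadd F u (vadd F v w))
      ≡⟨ cong₂ _*_ (δ-expand a b c) (Δ-expand u v w) ⟩
    ∑ words (wordTerm a b c) * ∑ grids (gridTerm u v w)
      ≡⟨ *-distribʳ-∑ _ words (wordTerm a b c) ⟩
    ∑[ ω ← words ] (wordTerm a b c ω * ∑ grids (gridTerm u v w))
      ≡⟨ ∑-cong words (λ ω → *-distribˡ-∑ (wordTerm a b c ω) grids (gridTerm u v w)) ⟩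
    ∑[ ω ← words ] ∑[ Ω ← grids ] (wordTerm a b c ω * gridTerm u v w Ω)
      ≡⟨ ∑-cong words (λ ω → ∑-cong grids (λ Ω → interleave _ _ _ _ _ _ _ _)) ⟩
    ∑[ ω ← words ] ∑[ Ω ← grids ] gridTerm (a ∷ u) (b ∷ v) (c ∷ w) (ω ∷ Ω)
      ≡⟨ sym (∑-cartesianProductWith _∷_ words grids _) ⟩
    ∑[ Ω ← allVecs words (suc N) ] gridTerm (a ∷ u) (b ∷ v) (c ∷ w) Ω ∎
    where
    open ≡-Reasoning
    grids : List (Grid N)
    grids = allVecs words N
    wordTerm : Carrier → Carrier → Carrier → Vec Pick δ-degree → Carrier
    wordTerm x y z ω = coefficient coefficients ω * monomial₃ x y z ω
    interleave : ∀ c x y z C X Y Z → (c * (x * (y * z))) * (C * (X * (Y * Z))) ≡ (c * C) * ((x * X) * ((y * Y) * (z * Z)))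
    interleave = solve 8 (λ c x y z C X Y Z →
      (c :* (x :* (y :* z))) :* (C :* (X :* (Y :* Z))) := (c :* C) :* ((x :* X) :* ((y :* Y) :* (z :* Z)))) refl

  count≤degree : ∀ c {k} (w : Vec Pick k) → count c w ≤ degree w
  count≤degree c₁ w = ℕ.m≤m+n (count c₁ w) _
  count≤degree c₂ w = ℕ.≤-trans (ℕ.m≤m+n (count c₂ w) _) (ℕ.m≤n+m _ (count c₁ w))
  count≤degree c₃ w = ℕ.≤-trans (ℕ.m≤n+m (count c₃ w) _) (ℕ.m≤n+m _ (count c₁ w))

  exponents<q : ∀ c {N} (Ω : Grid N) → VecAll.All (_< q) (exponents c Ω)
  exponents<q c []      = []
  exponents<q c (ω ∷ Ω) = ℕ.≤-<-trans (ℕ.≤-trans (count≤degree c ω) (degree≤length ω)) δ-degree<q ∷ exponents<q c Ω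

  gridDegree : ∀ {N} → Grid N → ℕ
  gridDegree Ω = Vec.sum (exponents c₁ Ω) ℕ.+ (Vec.sum (exponents c₂ Ω) ℕ.+ Vec.sum (exponents c₃ Ω))

  gridDegree≤ : ∀ {N} (Ω : Grid N) → gridDegree Ω ≤ N ℕ.* (q ∸ 1)
  gridDegree≤ []      = z≤n
  gridDegree≤ {suc N} (ω ∷ Ω) =
    subst (_≤ suc N ℕ.* (q ∸ 1)) (sym (shuffle (count c₁ ω) (count c₂ ω) (count c₃ ω) _ _ _))
    (ℕ.+-mono-≤ (ℕ.≤-trans (degree≤length ω) δ-degree≤q∸1) (gridDegree≤ Ω))
    where
    shuffle : ∀ a₁ a₂ a₃ s₁ s₂ s₃ →
      (a₁ ℕ.+ s₁) ℕ.+ ((a₂ ℕ.+ s₂) ℕ.+ (a₃ ℕ.+ s₃)) ≡ (a₁ ℕ.+ (a₂ ℕ.+ a₃)) ℕ.+ (s₁ ℕ.+ (s₂ ℕ.+ s₃))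
    shuffle = solve-∀

  colour : ∀ {N} → Grid N → Colour
  colour {N} Ω with small? q N (exponents c₁ Ω) | small? q N (exponents c₂ Ω)
  ... | yes _ | _     = c₁
  ... | no _  | yes _ = c₂
  ... | no _  | no _  = c₃

  -- The three exponent vectors of a grid have total degree at most N (q - 1), so one of them is small.
  colour-small : ∀ {N} (Ω : Grid N) → small q N (exponents (colour Ω) Ω)
  colour-small {N} Ω with small? q N (exponents c₁ Ω) | small? q N (exponents c₂ Ω) | small? q N (exponents c₃ Ω)
  ... | yes small₁ | _          | _          = small₁
  ... | no _       | yes small₂ | _          = small₂
  ... | no _       | no _       | yes small₃ = small₃
  ... | no ¬small₁ | no ¬small₂ | no ¬small₃ = contradiction (ℕ.*-monoʳ-≤ 3 (gridDegree≤ Ω)) (ℕ.<⇒≱ three-large)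
    where
    M s₁ s₂ s₃ : ℕ
    M = N ℕ.* (q ∸ 1)
    s₁ = Vec.sum (exponents c₁ Ω)
    s₂ = Vec.sum (exponents c₂ Ω)
    s₃ = Vec.sum (exponents c₃ Ω)
    three-large : 3 ℕ.* M < 3 ℕ.* gridDegree Ω
    three-large = subst₂ _<_ (thrice M) (distrib₃ s₁ s₂ s₃)
      (ℕ.+-mono-< (ℕ.≰⇒> ¬small₁) (ℕ.+-mono-< (ℕ.≰⇒> ¬small₂) (ℕ.≰⇒> ¬small₃)))
      where
      thrice : ∀ x → x ℕ.+ (x ℕ.+ x) ≡ 3 ℕ.* x
      thrice = solve-∀
      distrib₃ : ∀ a b c → 3 ℕ.* a ℕ.+ (3 ℕ.* b ℕ.+ 3 ℕ.* c) ≡ 3 ℕ.* (a ℕ.+ (b ℕ.+ c))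
      distrib₃ = solve-∀

  infix 4 _≟ᶜ_
  _≟ᶜ_ : DecidableEquality Colour
  c₁ ≟ᶜ c₁ = yes refl
  c₂ ≟ᶜ c₂ = yes refl
  c₃ ≟ᶜ c₃ = yes refl
  c₁ ≟ᶜ c₂ = no (λ ())
  c₁ ≟ᶜ c₃ = no (λ ())
  c₂ ≟ᶜ c₁ = no (λ ())
  c₂ ≟ᶜ c₃ = no (λ ())
  c₃ ≟ᶜ c₁ = no (λ ())
  c₃ ≟ᶜ c₂ = no (λ ())

  colours : List Colour
  colours = c₁ ∷ c₂ ∷ c₃ ∷ []

  colours⁺ : Unique colours
  colours⁺ = ((λ ()) All.∷ (λ ()) All.∷ All.[]) ∷ ((λ ()) All.∷ All.[]) ∷ All.[] ∷ []

  ∈-colours : ∀ c → c ∈ colours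
  ∈-colours c₁ = here refl
  ∈-colours c₂ = there (here refl)
  ∈-colours c₃ = there (there (here refl))

  -- Each grid is charged to the first colour whose exponent vector e is small; grouping the terms
  -- of that colour by e gives a slice, so there are 3 slices per small exponent vector.
  module Slicing {N : ℕ} {A : Set} (X Y Z : A → Vec Carrier N) where

    open SliceRank F A using (Slice; slice₁; slice₂; slice₃; ⟦_⟧; ∑⟦_⟧)

    infix 4 _≟ᵉ_
    _≟ᵉ_ : DecidableEquality (Vec ℕ N)
    _≟ᵉ_ = Vec.≡-dec ℕ._≟_

    grids : List (Grid N)
    grids = allVecs words N

    term : A → A → A → Grid N → Carrier
    term a b c = gridTerm (X a) (Y b) (Z c)

    inFibre : Colour → Vec ℕ N → Grid N → Carrier → Carrier
    inFibre j e Ω r = when (exponents j Ω ≟ᵉ e) (when (colour Ω ≟ᶜ j) r)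

    cofactor : Colour → Vec ℕ N → A → A → Carrier
    cofactor c₁ e b c = ∑[ Ω ← grids ] inFibre c₁ e Ω
      (gridCoefficient Ω * (monomial (Y b) (exponents c₂ Ω) * monomial (Z c) (exponents c₃ Ω)))
    cofactor c₂ e a c = ∑[ Ω ← grids ] inFibre c₂ e Ω
      (gridCoefficient Ω * (monomial (X a) (exponents c₁ Ω) * monomial (Z c) (exponents c₃ Ω)))
    cofactor c₃ e a b = ∑[ Ω ← grids ] inFibre c₃ e Ω
      (gridCoefficient Ω * (monomial (X a) (exponents c₁ Ω) * monomial (Y b) (exponents c₂ Ω)))

    sliceAt : Colour → Vec ℕ N → Slice
    sliceAt c₁ e = slice₁ (λ a → monomial (X a) e) (cofactor c₁ e)
    sliceAt c₂ e = slice₂ (λ b → monomial (Y b) e) (cofactor c₂ e)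
    sliceAt c₃ e = slice₃ (λ c → monomial (Z c) e) (cofactor c₃ e)

    slices : List Slice
    slices = cartesianProductWith sliceAt colours (smallVectors q N)

    private
      pull-in : ∀ j e (f : Vec ℕ N → Carrier) (R t : Grid N → Carrier) → (∀ Ω → f (exponents j Ω) * R Ω ≡ t Ω) →
        f e * ∑[ Ω ← grids ] inFibre j e Ω (R Ω) ≡ ∑[ Ω ← grids ] inFibre j e Ω (t Ω)
      pull-in j e f R t eq = trans (*-distribˡ-∑ (f e) grids _) (∑-cong grids (λ Ω →
        trans (*-when-≟ _≟ᵉ_ (exponents j Ω) e f _)
          (when-cong (exponents j Ω ≟ᵉ e) (trans (*-when (colour Ω ≟ᶜ j) _ _) (when-cong (colour Ω ≟ᶜ j) (eq Ω))))))

      rearrange₁ : ∀ x C y z → x * (C * (y * z)) ≡ C * (x * (y * z))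
      rearrange₁ = solve 4 (λ x C y z → x :* (C :* (y :* z)) := C :* (x :* (y :* z))) refl
      rearrange₂ : ∀ y C x z → y * (C * (x * z)) ≡ C * (x * (y * z))
      rearrange₂ = solve 4 (λ y C x z → y :* (C :* (x :* z)) := C :* (x :* (y :* z))) refl
      rearrange₃ : ∀ z C x y → z * (C * (x * y)) ≡ C * (x * (y * z))
      rearrange₃ = solve 4 (λ z C x y → z :* (C :* (x :* y)) := C :* (x :* (y :* z))) refl

    ⟦sliceAt⟧ : ∀ j e a b c → ⟦ sliceAt j e ⟧ a b c ≡ ∑[ Ω ← grids ] inFibre j e Ω (term a b c Ω)
    ⟦sliceAt⟧ c₁ e a b c = pull-in c₁ e (monomial (X a)) _ _ (λ Ω → rearrange₁ _ _ _ _)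
    ⟦sliceAt⟧ c₂ e a b c = pull-in c₂ e (monomial (Y b)) _ _ (λ Ω → rearrange₂ _ _ _ _)
    ⟦sliceAt⟧ c₃ e a b c = pull-in c₃ e (monomial (Z c)) _ _ (λ Ω → rearrange₃ _ _ _ _)

    ∑⟦slices⟧ : ∀ a b c → ∑⟦ slices ⟧ a b c ≡ Δ (vadd F (X a) (vadd F (Y b) (Z c)))
    ∑⟦slices⟧ a b c = begin
      ∑⟦ slices ⟧ a b c
        ≡⟨ ∑-cartesianProductWith sliceAt colours smalls (λ s → ⟦ s ⟧ a b c) ⟩
      ∑[ j ← colours ] ∑[ e ← smalls ] ⟦ sliceAt j e ⟧ a b c
        ≡⟨ ∑-cong colours (λ j → ∑-cong smalls (λ e → ⟦sliceAt⟧ j e a b c)) ⟩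
      ∑[ j ← colours ] ∑[ e ← smalls ] ∑[ Ω ← grids ] inFibre j e Ω (term a b c Ω)
        ≡⟨ ∑-cong colours (λ j →
             ∑-fibres _≟ᵉ_ (smallVectors⁺ q N) grids (exponents j) (λ Ω → when (colour Ω ≟ᶜ j) (term a b c Ω))) ⟩
      ∑[ j ← colours ] ∑[ Ω ← grids ] when (exponents j Ω ∈? smalls) (when (colour Ω ≟ᶜ j) (term a b c Ω))
        ≡⟨ ∑-cong colours (λ j → ∑-cong grids (λ Ω →
             when-when-implied (exponents j Ω ∈? smalls) (colour Ω ≟ᶜ j) (coloured-small j Ω) (term a b c Ω))) ⟩
      ∑[ j ← colours ] ∑[ Ω ← grids ] when (colour Ω ≟ᶜ j) (term a b c Ω)
        ≡⟨ ∑-comm colours grids (λ j Ω → when (colour Ω ≟ᶜ j) (term a b c Ω)) ⟩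
      ∑[ Ω ← grids ] ∑[ j ← colours ] when (colour Ω ≟ᶜ j) (term a b c Ω)
        ≡⟨ ∑-cong grids (λ Ω → ∑-when-∈ _≟ᶜ_ colours⁺ (∈-colours (colour Ω)) (term a b c Ω)) ⟩
      ∑[ Ω ← grids ] term a b c Ω
        ≡⟨ sym (Δ-expand (X a) (Y b) (Z c)) ⟩
      Δ (vadd F (X a) (vadd F (Y b) (Z c))) ∎
      where
      open ≡-Reasoning
      open import Data.List.Membership.DecPropositional _≟ᵉ_ using (_∈?_)
      smalls : List (Vec ℕ N)
      smalls = smallVectors q N
      coloured-small : ∀ j Ω → colour Ω ≡ j → exponents j Ω ∈ smalls
      coloured-small j Ω refl = ∈-smallVectors⁺ (exponents<q j Ω) (colour-small Ω)

    length-slices : length slices ≡ 3 ℕ.* length (smallVectors q N)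
    length-slices = length-cartesianProductWith sliceAt colours (smallVectors q N)

  record TricolouredSumFree {N} {A : Set} (X Y Z : A → Vec Carrier N) (S : List A) : Set where
    field
      sum≡0⇒diagonal : ∀ {a b c} → a ∈ S → b ∈ S → c ∈ S →
        vadd F (X a) (vadd F (Y b) (Z c)) ≡ Vec.replicate N 0# → a ≡ b × b ≡ c
      diagonal-sum≡0 : ∀ {a} → a ∈ S → vadd F (X a) (vadd F (Y a) (Z a)) ≡ Vec.replicate N 0#

  tricolouredSumFree-bound : ∀ {N} {A : Set} → DecidableEquality A → ∀ {X Y Z : A → Vec Carrier N} {S} →
    Unique S → TricolouredSumFree X Y Z S → length S ≤ 3 ℕ.* length (smallVectors q N)
  tricolouredSumFree-bound {N} {A} _≟ᴬ_ {X} {Y} {Z} {S} S! sumFree = subst (length S ≤_) length-slices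
    (diagonal⇒length≤slices _≟ᴬ_ (length slices) slices refl S!
      (DiagonalOn-transfer id (λ {a} {b} {c} _ _ _ → ∑⟦slices⟧ a b c) Δ-diagonal))
    where
    open Slicing X Y Z
    open SliceRank F A using (DiagonalOn; DiagonalOn-transfer; diagonal⇒length≤slices)
    open TricolouredSumFree sumFree
    Δ-diagonal : DiagonalOn S (λ a b c → Δ (vadd F (X a) (vadd F (Y b) (Z c))))
    Δ-diagonal .DiagonalOn.off-diagonal a∈ b∈ c∈ ¬diagonal =
      Δ-≢zeros _ (λ sum≡0 → ¬diagonal (sum≡0⇒diagonal a∈ b∈ c∈ sum≡0))
    Δ-diagonal .DiagonalOn.diagonal≢0 a∈ Δ≡0 =
      0≢1 (trans (sym Δ≡0) (trans (cong Δ (diagonal-sum≡0 a∈)) (Δ-zeros N)))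

  private
    vadd-++ : ∀ {m n} (u₁ v₁ : Vec Carrier m) (u₂ v₂ : Vec Carrier n) →
      vadd F (u₁ Vec.++ u₂) (v₁ Vec.++ v₂) ≡ vadd F u₁ v₁ Vec.++ vadd F u₂ v₂
    vadd-++ []       []       u₂ v₂ = refl
    vadd-++ (a ∷ u₁) (b ∷ v₁) u₂ v₂ = cong (a + b ∷_) (vadd-++ u₁ v₁ u₂ v₂)

    vadd₃-++ : ∀ {m n} (u₁ v₁ w₁ : Vec Carrier m) (u₂ v₂ w₂ : Vec Carrier n) →
      vadd F (u₁ Vec.++ u₂) (vadd F (v₁ Vec.++ v₂) (w₁ Vec.++ w₂)) ≡
      vadd F u₁ (vadd F v₁ w₁) Vec.++ vadd F u₂ (vadd F v₂ w₂)
    vadd₃-++ u₁ v₁ w₁ u₂ v₂ w₂ = trans (cong (vadd F (u₁ Vec.++ u₂)) (vadd-++ v₁ w₁ v₂ w₂)) (vadd-++ u₁ _ u₂ _)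

    replicate-++ : ∀ m n (z : Carrier) → Vec.replicate (m ℕ.+ n) z ≡ Vec.replicate m z Vec.++ Vec.replicate n z
    replicate-++ zero    n z = refl
    replicate-++ (suc m) n z = cong (z ∷_) (replicate-++ m n z)

  concatMap : ∀ {N} {A : Set} → (A → Vec Carrier N) → ∀ {k} → Vec A k → Vec Carrier (k ℕ.* N)
  concatMap X as = Vec.concat (Vec.map X as)

  TricolouredSumFree-allVecs : ∀ {N} {A : Set} {X Y Z : A → Vec Carrier N} {S} → TricolouredSumFree X Y Z S →
    ∀ k → TricolouredSumFree (concatMap X) (concatMap Y) (concatMap Z) (allVecs S k)
  TricolouredSumFree-allVecs {N} {A} {X} {Y} {Z} {S} sumFree k = record
    { sum≡0⇒diagonal = λ as∈ bs∈ cs∈ → blocks-diagonal (∈-allVecs⁻ as∈) (∈-allVecs⁻ bs∈) (∈-allVecs⁻ cs∈)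
    ; diagonal-sum≡0 = λ as∈ → blocks-sum≡0 (∈-allVecs⁻ as∈)
    }
    where
    open TricolouredSumFree sumFree
    blocks-diagonal : ∀ {k} {as bs cs : Vec A k} → VecAll.All (_∈ S) as → VecAll.All (_∈ S) bs → VecAll.All (_∈ S) cs →
      vadd F (concatMap X as) (vadd F (concatMap Y bs) (concatMap Z cs)) ≡ Vec.replicate (k ℕ.* N) 0# → as ≡ bs × bs ≡ cs
    blocks-diagonal [] [] [] _ = refl , refl
    blocks-diagonal {suc k} {a ∷ as} {b ∷ bs} {c ∷ cs} (a∈ ∷ as∈) (b∈ ∷ bs∈) (c∈ ∷ cs∈) sum≡0 =
      cong₂ _∷_ (proj₁ head) (proj₁ tail) , cong₂ _∷_ (proj₂ head) (proj₂ tail)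
      where
      split : vadd F (X a) (vadd F (Y b) (Z c)) Vec.++ vadd F (concatMap X as) (vadd F (concatMap Y bs) (concatMap Z cs))
            ≡ Vec.replicate N 0# Vec.++ Vec.replicate (k ℕ.* N) 0#
      split = trans (sym (vadd₃-++ (X a) (Y b) (Z c) _ _ _)) (trans sum≡0 (replicate-++ N (k ℕ.* N) 0#))
      head : a ≡ b × b ≡ c
      head = sum≡0⇒diagonal a∈ b∈ c∈ (Vec.++-injectiveˡ _ _ split)
      tail : as ≡ bs × bs ≡ cs
      tail = blocks-diagonal as∈ bs∈ cs∈ (Vec.++-injectiveʳ _ _ split)
    blocks-sum≡0 : ∀ {k} {as : Vec A k} → VecAll.All (_∈ S) as →
      vadd F (concatMap X as) (vadd F (concatMap Y as) (concatMap Z as)) ≡ Vec.replicate (k ℕ.* N) 0#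
    blocks-sum≡0 []                      = refl
    blocks-sum≡0 {suc k} {a ∷ as} (a∈ ∷ as∈) = begin
      vadd F (concatMap X (a ∷ as)) (vadd F (concatMap Y (a ∷ as)) (concatMap Z (a ∷ as)))
        ≡⟨ vadd₃-++ (X a) (Y a) (Z a) _ _ _ ⟩
      vadd F (X a) (vadd F (Y a) (Z a)) Vec.++ vadd F (concatMap X as) (vadd F (concatMap Y as) (concatMap Z as))
        ≡⟨ cong₂ Vec._++_ (diagonal-sum≡0 a∈) (blocks-sum≡0 as∈) ⟩
      Vec.replicate N 0# Vec.++ Vec.replicate (k ℕ.* N) 0#
        ≡⟨ sym (replicate-++ N (k ℕ.* N) 0#) ⟩
      Vec.replicate (suc k ℕ.* N) 0# ∎
      where open ≡-Reasoning

module Rational where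

  open import Defs using (powℚ; ℕtoℚ)
  open import Data.Nat as ℕ using (ℕ; zero; suc)
  import Data.Nat.Properties as ℕ
  open import Data.Integer as ℤ using (ℤ)
  import Data.Integer.Tactic.RingSolver as ℤ
  open import Data.Rational using (ℚ; mkℚ; *≤*; 0ℚ; 1ℚ; _+_; _-_; _*_; -_; 1/_; _≤_; _<_; toℚᵘ; positive; nonNegative)
  open import Data.Rational.Properties as ℚ using ()
  import Data.Rational.Unnormalised as ℚᵘ
  import Data.Rational.Unnormalised.Properties as ℚᵘ
  open import Data.Rational.Solver using (module +-*-Solver)
  open import Data.Product using (∃; _,_; proj₁; proj₂)
  open import Relation.Binary.PropositionalEquality
  open import Relation.Nullary using (yes; no; contradiction)

  open +-*-Solver using (solve; _:=_; _:+_; _:-_; _:*_; con)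

  0≤1 : 0ℚ ≤ 1ℚ
  0≤1 = ℚ.<⇒≤ (ℚ.positive⁻¹ 1ℚ)

  0≤*0≤ : ∀ {p q} → 0ℚ ≤ p → 0ℚ ≤ q → 0ℚ ≤ p * q
  0≤*0≤ {p} {q} 0≤p 0≤q = ℚ.nonNegative⁻¹ (p * q)
    {{ℚ.nonNeg*nonNeg⇒nonNeg p {{nonNegative 0≤p}} q {{nonNegative 0≤q}}}}

  0<*0< : ∀ {p q} → 0ℚ < p → 0ℚ < q → 0ℚ < p * q
  0<*0< {p} {q} 0<p 0<q = subst (_< p * q) (ℚ.*-zeroˡ q) (ℚ.*-monoˡ-<-pos q {{positive 0<q}} 0<p)

  *-monoˡ-≤ : ∀ {r p q} → 0ℚ ≤ r → p ≤ q → r * p ≤ r * q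
  *-monoˡ-≤ {r} 0≤r = ℚ.*-monoˡ-≤-nonNeg r {{nonNegative 0≤r}}

  *-monoʳ-≤ : ∀ {r p q} → 0ℚ ≤ r → p ≤ q → p * r ≤ q * r
  *-monoʳ-≤ {r} 0≤r = ℚ.*-monoʳ-≤-nonNeg r {{nonNegative 0≤r}}

  *-mono-≤ : ∀ {p q r s} → 0ℚ ≤ p → 0ℚ ≤ s → p ≤ q → r ≤ s → p * r ≤ q * s
  *-mono-≤ 0≤p 0≤s p≤q r≤s = ℚ.≤-trans (*-monoˡ-≤ 0≤p r≤s) (*-monoʳ-≤ 0≤s p≤q)

  ℕtoℚ-suc : ∀ n → ℕtoℚ (suc n) ≡ 1ℚ + ℕtoℚ n
  ℕtoℚ-suc n = ℚ.toℚᵘ-injective (begin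
    toℚᵘ (ℕtoℚ (suc n))                   ≈⟨ ℚ.toℚᵘ-fromℚᵘ (ℚᵘ.mkℚᵘ (ℤ.+ suc n) 0) ⟩
    ℚᵘ.mkℚᵘ (ℤ.+ suc n) 0                   ≈⟨ ℚᵘ.*≡* (1+x≡1+x (ℤ.+ n)) ⟩
    ℚᵘ.mkℚᵘ (ℤ.+ 1) 0 ℚᵘ.+ ℚᵘ.mkℚᵘ (ℤ.+ n) 0  ≈⟨ ℚᵘ.+-congʳ (ℚᵘ.mkℚᵘ (ℤ.+ 1) 0) (ℚᵘ.≃-sym (ℚ.toℚᵘ-fromℚᵘ (ℚᵘ.mkℚᵘ (ℤ.+ n) 0))) ⟩
    toℚᵘ 1ℚ ℚᵘ.+ toℚᵘ (ℕtoℚ n)            ≈⟨ ℚᵘ.≃-sym (ℚ.toℚᵘ-homo-+ 1ℚ (ℕtoℚ n)) ⟩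
    toℚᵘ (1ℚ + ℕtoℚ n)                    ∎)
    where
    open ℚᵘ.≃-Reasoning
    1+x≡1+x : ∀ (x : ℤ) → (ℤ.1ℤ ℤ.+ x) ℤ.* (ℤ.1ℤ ℤ.* ℤ.1ℤ) ≡ (ℤ.1ℤ ℤ.* ℤ.1ℤ ℤ.+ x ℤ.* ℤ.1ℤ) ℤ.* ℤ.1ℤ
    1+x≡1+x = ℤ.solve-∀

  ℕtoℚ-+ : ∀ m n → ℕtoℚ (m ℕ.+ n) ≡ ℕtoℚ m + ℕtoℚ n
  ℕtoℚ-+ zero    n = sym (ℚ.+-identityˡ (ℕtoℚ n))
  ℕtoℚ-+ (suc m) n = begin
    ℕtoℚ (suc (m ℕ.+ n))        ≡⟨ ℕtoℚ-suc (m ℕ.+ n) ⟩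
    1ℚ + ℕtoℚ (m ℕ.+ n)         ≡⟨ cong (1ℚ +_) (ℕtoℚ-+ m n) ⟩
    1ℚ + (ℕtoℚ m + ℕtoℚ n)      ≡⟨ sym (ℚ.+-assoc 1ℚ (ℕtoℚ m) (ℕtoℚ n)) ⟩
    (1ℚ + ℕtoℚ m) + ℕtoℚ n      ≡⟨ cong (_+ ℕtoℚ n) (sym (ℕtoℚ-suc m)) ⟩
    ℕtoℚ (suc m) + ℕtoℚ n       ∎
    where open ≡-Reasoning

  ℕtoℚ-* : ∀ m n → ℕtoℚ (m ℕ.* n) ≡ ℕtoℚ m * ℕtoℚ n
  ℕtoℚ-* zero    n = sym (ℚ.*-zeroˡ (ℕtoℚ n))
  ℕtoℚ-* (suc m) n = begin
    ℕtoℚ (n ℕ.+ m ℕ.* n)         ≡⟨ ℕtoℚ-+ n (m ℕ.* n) ⟩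
    ℕtoℚ n + ℕtoℚ (m ℕ.* n)      ≡⟨ cong (ℕtoℚ n +_) (ℕtoℚ-* m n) ⟩
    ℕtoℚ n + ℕtoℚ m * ℕtoℚ n     ≡⟨ cong (_+ ℕtoℚ m * ℕtoℚ n) (sym (ℚ.*-identityˡ (ℕtoℚ n))) ⟩
    1ℚ * ℕtoℚ n + ℕtoℚ m * ℕtoℚ n ≡⟨ sym (ℚ.*-distribʳ-+ (ℕtoℚ n) 1ℚ (ℕtoℚ m)) ⟩
    (1ℚ + ℕtoℚ m) * ℕtoℚ n       ≡⟨ cong (_* ℕtoℚ n) (sym (ℕtoℚ-suc m)) ⟩
    ℕtoℚ (suc m) * ℕtoℚ n        ∎
    where open ≡-Reasoning

  0≤ℕtoℚ : ∀ n → 0ℚ ≤ ℕtoℚ n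
  0≤ℕtoℚ zero    = ℚ.≤-refl
  0≤ℕtoℚ (suc n) = subst₂ _≤_ (ℚ.+-identityˡ 0ℚ) (sym (ℕtoℚ-suc n)) (ℚ.+-mono-≤ 0≤1 (0≤ℕtoℚ n))

  ℕtoℚ-mono-≤ : ∀ {m n} → m ℕ.≤ n → ℕtoℚ m ≤ ℕtoℚ n
  ℕtoℚ-mono-≤ {m} m≤n with ℕ.m≤n⇒∃[o]m+o≡n m≤n
  ... | k , refl = subst₂ _≤_ (ℚ.+-identityʳ (ℕtoℚ m)) (sym (ℕtoℚ-+ m k)) (ℚ.+-monoʳ-≤ (ℕtoℚ m) (0≤ℕtoℚ k))

  ℕtoℚ-^ : ∀ a k → ℕtoℚ (a ℕ.^ k) ≡ powℚ (ℕtoℚ a) k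
  ℕtoℚ-^ a zero    = refl
  ℕtoℚ-^ a (suc k) = trans (ℕtoℚ-* a (a ℕ.^ k)) (cong (ℕtoℚ a *_) (ℕtoℚ-^ a k))

  powℚ-+ : ∀ x m n → powℚ x (m ℕ.+ n) ≡ powℚ x m * powℚ x n
  powℚ-+ x zero    n = sym (ℚ.*-identityˡ _)
  powℚ-+ x (suc m) n = trans (cong (x *_) (powℚ-+ x m n)) (sym (ℚ.*-assoc x _ _))

  powℚ-* : ∀ x m n → powℚ x (m ℕ.* n) ≡ powℚ (powℚ x n) m
  powℚ-* x zero    n = refl
  powℚ-* x (suc m) n = trans (powℚ-+ x n (m ℕ.* n)) (cong (powℚ x n *_) (powℚ-* x m n))

  powℚ-distrib-* : ∀ x y k → powℚ (x * y) k ≡ powℚ x k * powℚ y k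
  powℚ-distrib-* x y zero    = sym (ℚ.*-identityˡ 1ℚ)
  powℚ-distrib-* x y (suc k) = trans (cong ((x * y) *_) (powℚ-distrib-* x y k)) (interchange x y (powℚ x k) (powℚ y k))
    where
    interchange : ∀ a b c d → (a * b) * (c * d) ≡ (a * c) * (b * d)
    interchange = solve 4 (λ a b c d → (a :* b) :* (c :* d) := (a :* c) :* (b :* d)) refl

  0≤powℚ : ∀ {x} k → 0ℚ ≤ x → 0ℚ ≤ powℚ x k
  0≤powℚ zero    _   = 0≤1
  0≤powℚ (suc k) 0≤x = 0≤*0≤ 0≤x (0≤powℚ k 0≤x)

  0<powℚ : ∀ {x} k → 0ℚ < x → 0ℚ < powℚ x k
  0<powℚ zero    _   = ℚ.positive⁻¹ 1ℚ
  0<powℚ (suc k) 0<x = 0<*0< 0<x (0<powℚ k 0<x)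

  powℚ-mono-≤ : ∀ {x y} k → 0ℚ ≤ x → x ≤ y → powℚ x k ≤ powℚ y k
  powℚ-mono-≤ zero    _   _   = ℚ.≤-refl
  powℚ-mono-≤ (suc k) 0≤x x≤y = *-mono-≤ 0≤x (0≤powℚ k (ℚ.≤-trans 0≤x x≤y)) x≤y (powℚ-mono-≤ k 0≤x x≤y)

  powℚ-1 : ∀ k → powℚ 1ℚ k ≡ 1ℚ
  powℚ-1 zero    = refl
  powℚ-1 (suc k) = trans (ℚ.*-identityˡ _) (powℚ-1 k)

  powℚ≤1 : ∀ {x} k → 0ℚ ≤ x → x ≤ 1ℚ → powℚ x k ≤ 1ℚ
  powℚ≤1 {x} k 0≤x x≤1 = subst (powℚ x k ≤_) (powℚ-1 k) (powℚ-mono-≤ k 0≤x x≤1)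

  1≤powℚ : ∀ {x} k → 1ℚ ≤ x → 1ℚ ≤ powℚ x k
  1≤powℚ {x} k 1≤x = subst (_≤ powℚ x k) (powℚ-1 k) (powℚ-mono-≤ k 0≤1 1≤x)

  powℚ-antimono : ∀ {x m n} → 0ℚ ≤ x → x ≤ 1ℚ → m ℕ.≤ n → powℚ x n ≤ powℚ x m
  powℚ-antimono {x} {m} 0≤x x≤1 m≤n with ℕ.m≤n⇒∃[o]m+o≡n m≤n
  ... | k , refl = subst₂ _≤_ (sym (powℚ-+ x m k)) (ℚ.*-identityʳ (powℚ x m))
    (*-monoˡ-≤ (0≤powℚ m 0≤x) (powℚ≤1 k 0≤x x≤1))

  p≤p+q : ∀ {p q} → 0ℚ ≤ q → p ≤ p + q
  p≤p+q {p} 0≤q = subst (_≤ p + _) (ℚ.+-identityʳ p) (ℚ.+-monoʳ-≤ p 0≤q)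

  ℕtoℚ<ℕtoℚ-suc : ∀ n → ℕtoℚ n < ℕtoℚ (suc n)
  ℕtoℚ<ℕtoℚ-suc n = subst₂ _<_ (ℚ.+-identityˡ (ℕtoℚ n)) (sym (ℕtoℚ-suc n))
    (ℚ.+-monoˡ-< (ℕtoℚ n) (ℚ.positive⁻¹ 1ℚ))

  archimedean : ∀ p → ∃ λ k → p < ℕtoℚ k
  archimedean p@(mkℚ ℤ.+[1+ n ] _ _) = suc (suc n) , ℚ.≤-<-trans p≤1+n (ℕtoℚ<ℕtoℚ-suc (suc n))
    where
    p≤1+n : p ≤ ℕtoℚ (suc n)
    p≤1+n = ℚ.toℚᵘ-cancel-≤ (ℚᵘ.≤-respʳ-≃ (ℚᵘ.≃-sym (ℚ.toℚᵘ-fromℚᵘ (ℚᵘ.mkℚᵘ (ℤ.+ suc n) 0)))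
      (ℚᵘ.*≤* (ℤ.+≤+ (ℕ.*-monoʳ-≤ (suc n) (ℕ.s≤s ℕ.z≤n)))))
  archimedean (mkℚ (ℤ.+ 0) _ _)      = 1 , ℚ.≤-<-trans (*≤* (ℤ.+≤+ ℕ.z≤n)) (ℚ.positive⁻¹ 1ℚ)
  archimedean (mkℚ ℤ.-[1+ _ ] _ _)   = 1 , ℚ.≤-<-trans (*≤* ℤ.-≤+) (ℚ.positive⁻¹ 1ℚ)

  archimedean-* : ∀ c {r} → 0ℚ < r → ∃ λ k → c < ℕtoℚ k * r
  archimedean-* c {r} 0<r = k , subst (_< ℕtoℚ k * r) c/r*r≡c (ℚ.*-monoˡ-<-pos r {{positive 0<r}} c/r<k)
    where
    instance _ = ℚ.pos⇒nonZero r {{positive 0<r}}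
    k : ℕ
    k = proj₁ (archimedean (c * 1/ r))
    c/r<k : c * 1/ r < ℕtoℚ k
    c/r<k = proj₂ (archimedean (c * 1/ r))
    c/r*r≡c : c * 1/ r * r ≡ c
    c/r*r≡c = trans (ℚ.*-assoc c (1/ r) r) (trans (cong (c *_) (ℚ.*-inverseˡ r)) (ℚ.*-identityʳ c))

  bernoulli : ∀ {h} k → 0ℚ ≤ h → 1ℚ + ℕtoℚ k * h ≤ powℚ (1ℚ + h) k
  bernoulli {h} zero    _   = ℚ.≤-reflexive (trans (cong (1ℚ +_) (ℚ.*-zeroˡ h)) (ℚ.+-identityʳ 1ℚ))
  bernoulli {h} (suc k) 0≤h = begin
    1ℚ + ℕtoℚ (suc k) * h                         ≡⟨ cong (λ z → 1ℚ + z * h) (ℕtoℚ-suc k) ⟩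
    1ℚ + (1ℚ + ℕtoℚ k) * h                        ≤⟨ p≤p+q (0≤*0≤ (0≤*0≤ (0≤ℕtoℚ k) 0≤h) 0≤h) ⟩
    (1ℚ + (1ℚ + ℕtoℚ k) * h) + (ℕtoℚ k * h) * h   ≡⟨ expand (ℕtoℚ k) h ⟩
    (1ℚ + h) * (1ℚ + ℕtoℚ k * h)                  ≤⟨ *-monoˡ-≤ 0≤1+h (bernoulli k 0≤h) ⟩
    (1ℚ + h) * powℚ (1ℚ + h) k                    ∎
    where
    open ℚ.≤-Reasoning
    0≤1+h : 0ℚ ≤ 1ℚ + h
    0≤1+h = ℚ.≤-trans 0≤1 (p≤p+q 0≤h)
    expand : ∀ k h → (1ℚ + (1ℚ + k) * h) + (k * h) * h ≡ (1ℚ + h) * (1ℚ + k * h)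
    expand = solve 2 (λ k h → (con 1ℚ :+ (con 1ℚ :+ k) :* h) :+ (k :* h) :* h := (con 1ℚ :+ h) :* (con 1ℚ :+ k :* h)) refl

  -- If Q > P then Q = P (1 + h) with h > 0, and by Bernoulli's inequality (1 + h)^k eventually exceeds c.
  powℚ-dominated⇒≤ : ∀ {P Q} c → 0ℚ < P → (∀ k → powℚ Q k ≤ ℕtoℚ c * powℚ P k) → Q ≤ P
  powℚ-dominated⇒≤ {P} {Q} c 0<P dominated with Q ℚ.≤? P
  ... | yes Q≤P = Q≤P
  ... | no Q≰P  = contradiction (ℚ.<-≤-trans (begin-strict
    ℕtoℚ c * powℚ P k              <⟨ ℚ.*-monoˡ-<-pos (powℚ P k) {{positive (0<powℚ k 0<P)}} c<1+kh ⟩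
    (1ℚ + ℕtoℚ k * h) * powℚ P k   ≤⟨ *-monoʳ-≤ (0≤powℚ k (ℚ.<⇒≤ 0<P)) (bernoulli k (ℚ.<⇒≤ 0<h)) ⟩
    powℚ (1ℚ + h) k * powℚ P k     ≡⟨ ℚ.*-comm _ (powℚ P k) ⟩
    powℚ P k * powℚ (1ℚ + h) k     ≡⟨ sym (powℚ-distrib-* P (1ℚ + h) k) ⟩
    powℚ (P * (1ℚ + h)) k          ≡⟨ cong (λ z → powℚ z k) P*[1+h]≡Q ⟩
    powℚ Q k                       ∎) (dominated k)) (ℚ.<-irrefl refl)
    where
    open ℚ.≤-Reasoning
    instance _ = ℚ.pos⇒nonZero P {{positive 0<P}}
    h : ℚ
    h = (Q - P) * 1/ P
    0<h : 0ℚ < h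
    0<h = 0<*0< (subst (_< Q - P) (ℚ.+-inverseʳ P) (ℚ.+-monoˡ-< (- P) (ℚ.≰⇒> Q≰P)))
                (ℚ.positive⁻¹ (1/ P) {{ℚ.1/pos⇒pos P {{positive 0<P}}}})
    P*[1+h]≡Q : P * (1ℚ + h) ≡ Q
    P*[1+h]≡Q = trans (rearrange P Q (1/ P)) (trans (cong (λ z → P + (Q - P) * z) (ℚ.*-inverseʳ P)) (cancel P Q))
      where
      rearrange : ∀ P Q i → P * (1ℚ + (Q - P) * i) ≡ P + (Q - P) * (P * i)
      rearrange = solve 3 (λ P Q i → P :* (con 1ℚ :+ (Q :- P) :* i) := P :+ (Q :- P) :* (P :* i)) refl
      cancel : ∀ P Q → P + (Q - P) * 1ℚ ≡ Q
      cancel = solve 2 (λ P Q → P :+ (Q :- P) :* con 1ℚ := Q) refl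
    k : ℕ
    k = proj₁ (archimedean-* (ℕtoℚ c) 0<h)
    c<1+kh : ℕtoℚ c < 1ℚ + ℕtoℚ k * h
    c<1+kh = ℚ.<-≤-trans (proj₂ (archimedean-* (ℕtoℚ c) 0<h))
      (subst (_≤ 1ℚ + ℕtoℚ k * h) (ℚ.+-identityˡ (ℕtoℚ k * h)) (ℚ.+-monoˡ-≤ (ℕtoℚ k * h) 0≤1))

module Counting where

  open import Defs using (powℚ; geomSum; ℕtoℚ)
  open import Data.Nat as ℕ using (ℕ; zero; suc; _∸_)
  import Data.Nat.Properties as ℕ
  open import Data.Nat.Tactic.RingSolver using (solve-∀)
  open import Data.Nat.DivMod using (_/_; m*n/n≡m; m/n*n≤m; /-monoˡ-≤)
  open import Data.List as List using (List; []; _∷_; filter; length; downFrom)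
  open import Data.List.Membership.Propositional using (_∈_)
  open import Data.List.Membership.Propositional.Properties using (∈-filter⁻)
  open import Data.List.Relation.Unary.Any using (here; there)
  open import Data.Rational using (ℚ; 0ℚ; 1ℚ; _+_; _*_; _≤_)
  open import Data.Rational.Properties as ℚ using ()
  open import Data.Vec as Vec using (Vec; []; _∷_)
  open import Data.Product using (proj₂)
  open import Function using (_∘_)
  open import Relation.Binary.PropositionalEquality
  open import Relation.Nullary using (yes; no)
  open import Relation.Unary using (Decidable)
  open Lists using (allVecs)
  open Small using (small; small?; smallVectors)
  open Rational
  open import Algebra.Bundles using (CommutativeRing)
  open Sum (CommutativeRing.commutativeSemiring ℚ.+-*-commutativeRing) using (∑; ∏; ∏-∑-distrib; ∑-cong)

  private
    variable
      A : Set

  ∑-filter≤∑ : ∀ {P : A → Set} (P? : Decidable P) (xs : List A) (f : A → ℚ) → (∀ x → 0ℚ ≤ f x) →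
    ∑ (filter P? xs) f ≤ ∑ xs f
  ∑-filter≤∑ P? []       f 0≤f = ℚ.≤-refl
  ∑-filter≤∑ P? (x ∷ xs) f 0≤f with P? x
  ... | yes _ = ℚ.+-monoʳ-≤ (f x) (∑-filter≤∑ P? xs f 0≤f)
  ... | no _  = subst (_≤ f x + ∑ xs f) (ℚ.+-identityˡ _) (ℚ.+-mono-≤ (0≤f x) (∑-filter≤∑ P? xs f 0≤f))

  length*≤∑ : ∀ (xs : List A) (f : A → ℚ) c → (∀ {x} → x ∈ xs → c ≤ f x) → ℕtoℚ (length xs) * c ≤ ∑ xs f
  length*≤∑ []       f c _    = ℚ.≤-reflexive (ℚ.*-zeroˡ c)
  length*≤∑ (x ∷ xs) f c c≤f = subst (_≤ f x + ∑ xs f) (sym length+1*c)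
    (ℚ.+-mono-≤ (c≤f (here refl)) (length*≤∑ xs f c (c≤f ∘ there)))
    where
    length+1*c : ℕtoℚ (suc (length xs)) * c ≡ c + ℕtoℚ (length xs) * c
    length+1*c = trans (cong (_* c) (ℕtoℚ-suc (length xs)))
      (trans (ℚ.*-distribʳ-+ c 1ℚ (ℕtoℚ (length xs))) (cong (_+ ℕtoℚ (length xs) * c) (ℚ.*-identityˡ c)))

  geomSum≡∑ : ∀ x q → geomSum x q ≡ ∑ (downFrom q) (powℚ x)
  geomSum≡∑ x zero    = refl
  geomSum≡∑ x (suc q) = cong (powℚ x q +_) (geomSum≡∑ x q)

  ∑-powℚ-sum : ∀ x q N → ∑ (allVecs (downFrom q) N) (powℚ x ∘ Vec.sum) ≡ powℚ (geomSum x q) N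
  ∑-powℚ-sum x q N = begin
    ∑ (allVecs (downFrom q) N) (powℚ x ∘ Vec.sum)
      ≡⟨ sym (∑-cong (allVecs (downFrom q) N) ∏-powℚ) ⟩
    ∑ (allVecs (downFrom q) N) (∏ ∘ Vec.zipWith powℚ (Vec.replicate N x))
      ≡⟨ sym (∏-∑-distrib (downFrom q) powℚ (Vec.replicate N x)) ⟩
    ∏ (Vec.map (λ y → ∑ (downFrom q) (powℚ y)) (Vec.replicate N x))
      ≡⟨ ∏-replicate N ⟩
    powℚ (∑ (downFrom q) (powℚ x)) N
      ≡⟨ cong (λ z → powℚ z N) (sym (geomSum≡∑ x q)) ⟩
    powℚ (geomSum x q) N ∎
    where
    open ≡-Reasoning
    ∏-powℚ : ∀ {n} (e : Vec ℕ n) → ∏ (Vec.zipWith powℚ (Vec.replicate n x) e) ≡ powℚ x (Vec.sum e)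
    ∏-powℚ []      = refl
    ∏-powℚ (i ∷ e) = trans (cong (powℚ x i *_) (∏-powℚ e)) (sym (powℚ-+ x i (Vec.sum e)))
    ∏-replicate : ∀ n →
      ∏ (Vec.map (λ y → ∑ (downFrom q) (powℚ y)) (Vec.replicate n x)) ≡ powℚ (∑ (downFrom q) (powℚ x)) n
    ∏-replicate zero    = refl
    ∏-replicate (suc n) = cong (∑ (downFrom q) (powℚ x) *_) (∏-replicate n)

  smallVectors-bound : ∀ q N {x} → 0ℚ ≤ x → x ≤ 1ℚ →
    powℚ (ℕtoℚ (length (smallVectors q N))) 3 * powℚ x (N ℕ.* (q ∸ 1)) ≤ powℚ (geomSum x q) (3 ℕ.* N)
  smallVectors-bound q N {x} 0≤x x≤1 = begin
    powℚ (ℕtoℚ #small) 3 * powℚ x M               ≤⟨ *-monoˡ-≤ (0≤powℚ 3 (0≤ℕtoℚ #small)) x^M≤[x^k]³ ⟩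
    powℚ (ℕtoℚ #small) 3 * powℚ (powℚ x k) 3      ≡⟨ sym (powℚ-distrib-* (ℕtoℚ #small) (powℚ x k) 3) ⟩
    powℚ (ℕtoℚ #small * powℚ x k) 3               ≤⟨ powℚ-mono-≤ 3 (0≤*0≤ (0≤ℕtoℚ #small) (0≤powℚ k 0≤x)) #small*x^k≤G^N ⟩
    powℚ (powℚ (geomSum x q) N) 3                 ≡⟨ sym (powℚ-* (geomSum x q) 3 N) ⟩
    powℚ (geomSum x q) (3 ℕ.* N)                  ∎
    where
    open ℚ.≤-Reasoning
    M : ℕ
    M = N ℕ.* (q ∸ 1)
    -- Every small vector has coordinate sum at most k, so its weight is at least x^k.
    k : ℕ
    k = M / 3
    #small : ℕ
    #small = length (smallVectors q N)
    x^M≤[x^k]³ : powℚ x M ≤ powℚ (powℚ x k) 3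
    x^M≤[x^k]³ = subst (powℚ x M ≤_) (powℚ-* x 3 k)
      (powℚ-antimono 0≤x x≤1 (subst (ℕ._≤ M) (ℕ.*-comm k 3) (m/n*n≤m M 3)))
    small⇒≤k : ∀ {e} → small q N e → Vec.sum e ℕ.≤ k
    small⇒≤k {e} 3|e|≤M = subst (ℕ._≤ k) (trans (cong (_/ 3) (ℕ.*-comm 3 (Vec.sum e))) (m*n/n≡m (Vec.sum e) 3))
      (/-monoˡ-≤ 3 3|e|≤M)
    #small*x^k≤G^N : ℕtoℚ #small * powℚ x k ≤ powℚ (geomSum x q) N
    #small*x^k≤G^N = ℚ.≤-trans
      (length*≤∑ (smallVectors q N) (powℚ x ∘ Vec.sum) (powℚ x k)
        (λ {e} e∈ → powℚ-antimono 0≤x x≤1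
          (small⇒≤k {e} (proj₂ (∈-filter⁻ (small? q N) {xs = allVecs (downFrom q) N} e∈)))))
      (ℚ.≤-trans
        (∑-filter≤∑ (small? q N) (allVecs (downFrom q) N) (powℚ x ∘ Vec.sum) (λ e → 0≤powℚ (Vec.sum e) 0≤x))
        (ℚ.≤-reflexive (∑-powℚ-sum x q N)))

  1≤geomSum : ∀ {x} q → 1 ℕ.≤ q → 0ℚ ≤ x → 1ℚ ≤ geomSum x q
  1≤geomSum (suc zero)    _ _   = ℚ.≤-reflexive (sym (ℚ.+-identityʳ 1ℚ))
  1≤geomSum {x} (suc (suc q)) _ 0≤x = ℚ.≤-trans (1≤geomSum (suc q) (ℕ.s≤s ℕ.z≤n) 0≤x)
    (subst (_≤ powℚ x (suc q) + geomSum x (suc q)) (ℚ.+-identityˡ (geomSum x (suc q)))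
      (ℚ.+-monoˡ-≤ (geomSum x (suc q)) (0≤powℚ (suc q) 0≤x)))

  -- The tensor power trick: the constant 3 (27 after cubing) disappears in the limit k → ∞.
  tensorPower-bound : ∀ q n s {x} → 1 ℕ.≤ q → 0ℚ ≤ x → x ≤ 1ℚ →
    (∀ k → s ℕ.^ k ℕ.≤ 3 ℕ.* length (smallVectors q (k ℕ.* n))) →
    powℚ (ℕtoℚ s) 3 * powℚ x (n ℕ.* (q ∸ 1)) ≤ powℚ (geomSum x q) (3 ℕ.* n)
  tensorPower-bound q n s {x} 1≤q 0≤x x≤1 power-bound =
    powℚ-dominated⇒≤ 27 (ℚ.<-≤-trans (ℚ.positive⁻¹ 1ℚ) (1≤powℚ (3 ℕ.* n) (1≤geomSum q 1≤q 0≤x))) dominated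
    where
    G : ℚ
    G = geomSum x q
    X : ℚ
    X = powℚ x (n ℕ.* (q ∸ 1))
    dominated : ∀ k → powℚ (powℚ (ℕtoℚ s) 3 * X) k ≤ ℕtoℚ 27 * powℚ (powℚ G (3 ℕ.* n)) k
    dominated k = begin
      powℚ (powℚ (ℕtoℚ s) 3 * X) k
        ≡⟨ powℚ-distrib-* (powℚ (ℕtoℚ s) 3) X k ⟩
      powℚ (powℚ (ℕtoℚ s) 3) k * powℚ X k
        ≡⟨ cong₂ _*_ s³ᵏ≡[sᵏ]³ Xᵏ≡x^kn[q-1] ⟩
      powℚ (ℕtoℚ (s ℕ.^ k)) 3 * powℚ x (k ℕ.* n ℕ.* (q ∸ 1))
        ≤⟨ *-monoʳ-≤ (0≤powℚ (k ℕ.* n ℕ.* (q ∸ 1)) 0≤x)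
             (powℚ-mono-≤ 3 (0≤ℕtoℚ (s ℕ.^ k)) (ℕtoℚ-mono-≤ (power-bound k))) ⟩
      powℚ (ℕtoℚ (3 ℕ.* #small)) 3 * powℚ x (k ℕ.* n ℕ.* (q ∸ 1))
        ≡⟨ cong (_* powℚ x (k ℕ.* n ℕ.* (q ∸ 1))) (trans (cong (λ z → powℚ z 3) (ℕtoℚ-* 3 #small))
             (powℚ-distrib-* (ℕtoℚ 3) (ℕtoℚ #small) 3)) ⟩
      (ℕtoℚ 27 * powℚ (ℕtoℚ #small) 3) * powℚ x (k ℕ.* n ℕ.* (q ∸ 1))
        ≡⟨ ℚ.*-assoc (ℕtoℚ 27) (powℚ (ℕtoℚ #small) 3) (powℚ x (k ℕ.* n ℕ.* (q ∸ 1))) ⟩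
      ℕtoℚ 27 * (powℚ (ℕtoℚ #small) 3 * powℚ x (k ℕ.* n ℕ.* (q ∸ 1)))
        ≤⟨ *-monoˡ-≤ (0≤ℕtoℚ 27) (smallVectors-bound q (k ℕ.* n) 0≤x x≤1) ⟩
      ℕtoℚ 27 * powℚ G (3 ℕ.* (k ℕ.* n))
        ≡⟨ cong (ℕtoℚ 27 *_) (trans (cong (powℚ G) (3[kn]≡k[3n] k n)) (powℚ-* G k (3 ℕ.* n))) ⟩
      ℕtoℚ 27 * powℚ (powℚ G (3 ℕ.* n)) k ∎
      where
      open ℚ.≤-Reasoning
      #small : ℕ
      #small = length (smallVectors q (k ℕ.* n))
      s³ᵏ≡[sᵏ]³ : powℚ (powℚ (ℕtoℚ s) 3) k ≡ powℚ (ℕtoℚ (s ℕ.^ k)) 3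
      s³ᵏ≡[sᵏ]³ = begin-equality
        powℚ (powℚ (ℕtoℚ s) 3) k    ≡⟨ sym (powℚ-* (ℕtoℚ s) k 3) ⟩
        powℚ (ℕtoℚ s) (k ℕ.* 3)     ≡⟨ cong (powℚ (ℕtoℚ s)) (ℕ.*-comm k 3) ⟩
        powℚ (ℕtoℚ s) (3 ℕ.* k)     ≡⟨ powℚ-* (ℕtoℚ s) 3 k ⟩
        powℚ (powℚ (ℕtoℚ s) k) 3    ≡⟨ cong (λ z → powℚ z 3) (sym (ℕtoℚ-^ s k)) ⟩
        powℚ (ℕtoℚ (s ℕ.^ k)) 3     ∎
      3[kn]≡k[3n] : ∀ k n → 3 ℕ.* (k ℕ.* n) ≡ k ℕ.* (3 ℕ.* n)
      3[kn]≡k[3n] = solve-∀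
      Xᵏ≡x^kn[q-1] : powℚ X k ≡ powℚ x (k ℕ.* n ℕ.* (q ∸ 1))
      Xᵏ≡x^kn[q-1] = trans (sym (powℚ-* x k (n ℕ.* (q ∸ 1)))) (cong (powℚ x) (sym (ℕ.*-assoc k n (q ∸ 1))))

module IndependentSet {L : ℕ} (E : Fin L → Fin L → Set) (E? : ∀ u v → Dec (E u v)) where

  open import Data.Nat using (zero; suc; _+_; _*_; _≤_; z≤n; s≤s)
  import Data.Nat.Properties as ℕ
  open import Data.Nat.Tactic.RingSolver using (solve-∀)
  open import Data.Bool using (Bool; true; false; _∧_; not; T)
  import Data.Fin.Properties as Fin
  open import Data.List using (List; []; _∷_; allFin; length)
  open import Data.List.Properties using (length-tabulate)
  open import Data.List.Membership.Propositional using (_∈_; find)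
  open import Data.List.Membership.Propositional.Properties using (∈-allFin)
  open import Data.List.Relation.Unary.Any using (here; there; any?)
  import Data.List.Relation.Unary.All as All
  open import Data.List.Relation.Unary.All.Properties using (¬Any⇒All¬)
  open import Data.List.Relation.Unary.Unique.Propositional using (Unique; []; _∷_)
  open import Data.List.Relation.Unary.Unique.Propositional.Properties using (allFin⁺)
  open import Data.Product using (∃; _×_; _,_; proj₁; proj₂)
  open import Function using (_∘_)
  open import Relation.Binary.PropositionalEquality
  open import Relation.Nullary using (¬_; yes; no; contradiction)
  open import Relation.Nullary.Decidable using (⌊_⌋; _×-dec_; T?)
  open Sum ℕ.+-*-commutativeSemiring
    using (∑; when; ∑-cong; ∑-comm; ∑-distrib-+; *-distribˡ-∑; *-distribʳ-∑; ∑-when-∈)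
  open NatSum using (∑-mono-≤)

  ind : Bool → ℕ
  ind true  = 1
  ind false = 0

  ind*≤ : ∀ b n → ind b * n ≤ n
  ind*≤ true  n = ℕ.≤-reflexive (ℕ.*-identityˡ n)
  ind*≤ false n = z≤n

  vertices : List (Fin L)
  vertices = allFin L

  Subset : Set
  Subset = Fin L → Bool

  size : Subset → ℕ
  size V = ∑[ u ← vertices ] ind (V u)

  outdegree : Fin L → ℕ
  outdegree u = ∑[ v ← vertices ] when (E? u v) 1

  indegreeIn : Subset → Fin L → ℕ
  indegreeIn V v = ∑[ u ← vertices ] (ind (V u) * when (E? u v) 1)

  outdegreeIn : Subset → Fin L → ℕ
  outdegreeIn V u = ∑[ v ← vertices ] (ind (V v) * when (E? u v) 1)

  Independent : List (Fin L) → Set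
  Independent S = ∀ {a b} → a ∈ S → b ∈ S → ¬ E a b

  ∑-indegreeIn≡∑-outdegreeIn : ∀ V →
    ∑[ v ← vertices ] (ind (V v) * indegreeIn V v) ≡ ∑[ u ← vertices ] (ind (V u) * outdegreeIn V u)
  ∑-indegreeIn≡∑-outdegreeIn V = begin
    ∑[ v ← vertices ] (ind (V v) * ∑[ u ← vertices ] (ind (V u) * when (E? u v) 1))
      ≡⟨ ∑-cong vertices (λ v → *-distribˡ-∑ (ind (V v)) vertices _) ⟩
    ∑[ v ← vertices ] ∑[ u ← vertices ] (ind (V v) * (ind (V u) * when (E? u v) 1))
      ≡⟨ ∑-comm vertices vertices _ ⟩
    ∑[ u ← vertices ] ∑[ v ← vertices ] (ind (V v) * (ind (V u) * when (E? u v) 1))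
      ≡⟨ ∑-cong vertices (λ u → ∑-cong vertices (λ v → swap (ind (V v)) (ind (V u)) _)) ⟩
    ∑[ u ← vertices ] ∑[ v ← vertices ] (ind (V u) * (ind (V v) * when (E? u v) 1))
      ≡⟨ ∑-cong vertices (λ u → sym (*-distribˡ-∑ (ind (V u)) vertices _)) ⟩
    ∑[ u ← vertices ] (ind (V u) * ∑[ v ← vertices ] (ind (V v) * when (E? u v) 1)) ∎
    where
    open ≡-Reasoning
    swap : ∀ a b c → a * (b * c) ≡ b * (a * c)
    swap = solve-∀

  remove : Subset → Fin L → Subset
  remove V v u = V u ∧ not ⌊ v Fin.≟ u ⌋ ∧ not ⌊ E? u v ⌋ ∧ not ⌊ E? v u ⌋

  ∈-remove⁻ : ∀ V v u → T (remove V v u) → T (V u) × v ≢ u × ¬ E u v × ¬ E v u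
  ∈-remove⁻ V v u ∈remove with V u | v Fin.≟ u | E? u v | E? v u
  ... | true | no v≢u | no ¬Euv | no ¬Evu = _ , v≢u , ¬Euv , ¬Evu

  size-remove< : ∀ V v → T (V v) → size (remove V v) + 1 ≤ size V
  size-remove< V v v∈V = subst (_≤ size V) split (∑-mono-≤ vertices removed-or-v)
    where
    removed-or-v : ∀ u → ind (remove V v u) + when (v Fin.≟ u) 1 ≤ ind (V u)
    removed-or-v u with V u in Vu | v Fin.≟ u
    ... | false | yes refl = contradiction (subst T Vu v∈V) λ ()
    ... | false | no _     = z≤n
    ... | true  | yes refl = ℕ.≤-refl
    ... | true  | no _ with E? u v | E? v u
    ...   | yes _ | _     = z≤n
    ...   | no _  | yes _ = z≤n
    ...   | no _  | no _  = ℕ.≤-refl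
    split : ∑[ u ← vertices ] (ind (remove V v u) + when (v Fin.≟ u) 1) ≡ size (remove V v) + 1
    split = trans (∑-distrib-+ vertices _ _) (cong (size (remove V v) +_) (∑-when-∈ Fin._≟_ (allFin⁺ L) (∈-allFin v) 1))

  size≤size-remove : ∀ V v → size V ≤ size (remove V v) + (1 + (indegreeIn V v + outdegreeIn V v))
  size≤size-remove V v = subst (size V ≤_) split (∑-mono-≤ vertices covered)
    where
    covered : ∀ u → ind (V u) ≤
      ind (remove V v u) + (when (v Fin.≟ u) 1 + (ind (V u) * when (E? u v) 1 + ind (V u) * when (E? v u) 1))
    covered u with V u
    ... | false = z≤n
    ... | true with v Fin.≟ u
    ...   | yes _ = s≤s z≤n
    ...   | no _ with E? u v | E? v u
    ...     | yes _ | _     = s≤s z≤n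
    ...     | no _  | yes _ = s≤s z≤n
    ...     | no _  | no _  = s≤s z≤n
    split : ∑[ u ← vertices ]
              (ind (remove V v u) + (when (v Fin.≟ u) 1 + (ind (V u) * when (E? u v) 1 + ind (V u) * when (E? v u) 1)))
          ≡ size (remove V v) + (1 + (indegreeIn V v + outdegreeIn V v))
    split = trans (∑-distrib-+ vertices _ _) (cong (size (remove V v) +_) (trans (∑-distrib-+ vertices _ _)
      (cong₂ _+_ (∑-when-∈ Fin._≟_ (allFin⁺ L) (∈-allFin v) 1) (∑-distrib-+ vertices _ _))))

  module _ {d : ℕ} (outdegree≤d : ∀ u → outdegree u ≤ d) where

    outdegreeIn≤d : ∀ V u → outdegreeIn V u ≤ d
    outdegreeIn≤d V u = ℕ.≤-trans (∑-mono-≤ vertices (λ v → ind*≤ (V v) _)) (outdegree≤d u)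

    -- Double counting: the in-degrees within V average to at most d.
    low-indegree : ∀ V → 1 ≤ size V → ∃ λ v → T (V v) × indegreeIn V v ≤ d
    low-indegree V 1≤size with any? (λ v → T? (V v) ×-dec (indegreeIn V v ℕ.≤? d)) vertices
    ... | yes found = proj₁ (find found) , proj₂ (proj₂ (find found))
    ... | no none   = contradiction (ℕ.≤-trans 1≤size (ℕ.+-cancelʳ-≤ (size V * d) (size V) 0 size+size*d≤size*d)) λ ()
      where
      high : ∀ v → ind (V v) * suc d ≤ ind (V v) * indegreeIn V v
      high v with V v in Vv
      ... | false = z≤n
      ... | true  = ℕ.*-monoʳ-≤ 1 (ℕ.≰⇒> (λ in≤d →
        All.lookup (¬Any⇒All¬ vertices none) (∈-allFin v) (subst T (sym Vv) _ , in≤d)))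
      size+size*d≤size*d : size V + size V * d ≤ 0 + size V * d
      size+size*d≤size*d = begin
        size V + size V * d                                   ≡⟨ sym (ℕ.*-suc (size V) d) ⟩
        size V * suc d                                        ≡⟨ *-distribʳ-∑ (suc d) vertices (ind ∘ V) ⟩
        ∑[ v ← vertices ] (ind (V v) * suc d)                 ≤⟨ ∑-mono-≤ vertices high ⟩
        ∑[ v ← vertices ] (ind (V v) * indegreeIn V v)        ≡⟨ ∑-indegreeIn≡∑-outdegreeIn V ⟩
        ∑[ u ← vertices ] (ind (V u) * outdegreeIn V u)       ≤⟨ ∑-mono-≤ vertices (λ u → ℕ.*-monoʳ-≤ (ind (V u)) (outdegreeIn≤d V u)) ⟩
        ∑[ u ← vertices ] (ind (V u) * d)                     ≡⟨ sym (*-distribʳ-∑ d vertices (ind ∘ V)) ⟩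
        size V * d                                            ∎
        where open ℕ.≤-Reasoning

    record IndependentSubset (V : Subset) : Set where
      field
        members     : List (Fin L)
        unique      : Unique members
        ⊆V          : ∀ {u} → u ∈ members → T (V u)
        independent : Independent members
        large       : size V ≤ suc (2 * d) * length members

    module _ (irreflexive : ∀ u → ¬ E u u) where

      -- Keep a vertex of in-degree at most d within V, and delete it and its at most 2 d neighbours from V.
      greedy : ∀ n V → size V ≤ n → IndependentSubset V
      greedy n V size≤n with size V ℕ.≤? 0
      ... | yes size≤0 = record
        { members = [] ; unique = [] ; ⊆V = λ () ; independent = λ ()
        ; large = subst (size V ≤_) (sym (ℕ.*-zeroʳ (suc (2 * d)))) size≤0 }
      greedy zero    V size≤0 | no size≰0 = contradiction size≤0 size≰0
      greedy (suc n) V size≤n | no size≰0 with low-indegree V (ℕ.≰⇒> size≰0)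
      ... | v , v∈V , indegree≤d = record
        { members = v ∷ members
        ; unique = All.tabulate (λ u∈ → proj₁ (proj₂ (∈-remove⁻ V v _ (⊆V u∈)))) ∷ unique
        ; ⊆V = λ { (here refl) → v∈V ; (there u∈) → proj₁ (∈-remove⁻ V v _ (⊆V u∈)) }
        ; independent = independent′
        ; large = large′
        }
        where
        rest : IndependentSubset (remove V v)
        rest = greedy n (remove V v) (ℕ.≤-pred (subst (_≤ suc n) (ℕ.+-comm (size (remove V v)) 1)
          (ℕ.≤-trans (size-remove< V v v∈V) size≤n)))
        open IndependentSubset rest
        independent′ : Independent (v ∷ members)
        independent′ (here refl) (here refl) = irreflexive v
        independent′ (here refl) (there b∈) = proj₂ (proj₂ (proj₂ (∈-remove⁻ V v _ (⊆V b∈))))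
        independent′ (there a∈) (here refl) = proj₁ (proj₂ (proj₂ (∈-remove⁻ V v _ (⊆V a∈))))
        independent′ (there a∈) (there b∈) = independent a∈ b∈
        large′ : size V ≤ suc (2 * d) * suc (length members)
        large′ = begin
          size V
            ≤⟨ size≤size-remove V v ⟩
          size (remove V v) + (1 + (indegreeIn V v + outdegreeIn V v))
            ≤⟨ ℕ.+-mono-≤ large (s≤s (ℕ.+-mono-≤ indegree≤d (outdegreeIn≤d V v))) ⟩
          suc (2 * d) * length members + (1 + (d + d))
            ≡⟨ step (length members) d ⟩
          suc (2 * d) * suc (length members) ∎
          where
          open ℕ.≤-Reasoning
          step : ∀ m d → suc (2 * d) * m + (1 + (d + d)) ≡ suc (2 * d) * suc m
          step = solve-∀

      independentSet : ∃ λ S → Unique S × Independent S × L ≤ suc (2 * d) * length S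
      independentSet = members , unique , independent , subst (_≤ suc (2 * d) * length members) size-all large
        where
        ∑-1≡length : ∀ (xs : List (Fin L)) → ∑[ _ ← xs ] 1 ≡ length xs
        ∑-1≡length []       = refl
        ∑-1≡length (_ ∷ xs) = cong suc (∑-1≡length xs)
        everything : Subset
        everything _ = true
        size-all : size everything ≡ L
        size-all = trans (∑-1≡length vertices) (length-tabulate (λ i → i))
        open IndependentSubset (greedy L everything (ℕ.≤-reflexive size-all))

module Solutions where

  open import Defs
  open import Data.Nat as ℕ using (ℕ; zero; suc; _≤_; _<_; _∸_; z≤n; s≤s)
  import Data.Nat.Properties as ℕ
  open import Data.Nat.Tactic.RingSolver using (solve-∀)
  open import Data.Fin as Fin using (Fin)
  import Data.Fin.Properties as Fin
  open import Data.List using (List; length; filter; lookup; allFin; cartesianProduct)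
  open import Data.List.Membership.Propositional using (_∈_; find)
  open import Data.List.Membership.Propositional.Properties using (∈-filter⁻; ∈-lookup; ∈-allFin)
  open import Data.List.Relation.Unary.Any using (Any; any?)
  import Data.List.Relation.Unary.Any as Any
  open import Data.List.Relation.Unary.Unique.Propositional using (Unique)
  open import Data.List.Relation.Unary.Unique.Propositional.Properties using (filter⁺; cartesianProduct⁺; allFin⁺)
  open import Data.Vec as Vec using (Vec)
  import Data.Vec.Properties as Vec
  open import Data.Rational as ℚ using (ℚ; 0ℚ; 1ℚ)
  import Data.Rational.Properties as ℚ
  open import Data.Product using (∃; ∃-syntax; _×_; _,_; proj₁; proj₂)
  open import Function using (_∘_)
  open import Function.Definitions using (Injective)
  open import Relation.Binary.PropositionalEquality
  open import Relation.Nullary using (¬_; Dec; yes; no; ¬?; contradiction)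
  open import Relation.Nullary.Decidable using (_×-dec_)
  open Lists using (allVecs⁺; length-allVecs; lookup-injective)
  open Small using (smallVectors)
  open Rational
  open Counting using (1≤geomSum; tensorPower-bound)
  open Sum ℕ.+-*-commutativeSemiring using (∑; when; ∑-cartesianProductWith)
  open NatSum using (∑-mono-≤; length-filter≡∑; when-any≤∑)

  cube-comparison : ∀ d L s {X P} → L ≤ suc (2 ℕ.* d) ℕ.* s → 0ℚ ℚ.≤ X → X ℚ.≤ 1ℚ → 1ℚ ℚ.≤ P →
    powℚ (ℕtoℚ s) 3 ℚ.* X ℚ.≤ P →
    ¬ (powℚ (ℕtoℚ (4 ℕ.* suc d)) 3 ℚ.* P ℚ.< powℚ (ℕtoℚ L ℚ.+ 1ℚ) 3 ℚ.* X)
  cube-comparison d L s {X} {P} L≤ 0≤X X≤1 1≤P s³X≤P b³P<a³X =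
    ℚ.<-irrefl refl (ℚ.<-≤-trans b³P<a³X (a³X≤b³P s L≤ s³X≤P))
    where
    open ℚ.≤-Reasoning
    b : ℚ
    b = ℕtoℚ (4 ℕ.* suc d)
    0≤b³ : 0ℚ ℚ.≤ powℚ b 3
    0≤b³ = 0≤powℚ 3 (0≤ℕtoℚ (4 ℕ.* suc d))
    a³X≤b³P : ∀ s → L ≤ suc (2 ℕ.* d) ℕ.* s → powℚ (ℕtoℚ s) 3 ℚ.* X ℚ.≤ P →
      powℚ (ℕtoℚ L ℚ.+ 1ℚ) 3 ℚ.* X ℚ.≤ powℚ b 3 ℚ.* P
    a³X≤b³P zero L≤0 _ = begin
      powℚ (ℕtoℚ L ℚ.+ 1ℚ) 3 ℚ.* X  ≡⟨ cong (λ L → powℚ (ℕtoℚ L ℚ.+ 1ℚ) 3 ℚ.* X) L≡0 ⟩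
      powℚ 1ℚ 3 ℚ.* X                ≡⟨ ℚ.*-identityˡ X ⟩
      X                              ≤⟨ X≤1 ⟩
      1ℚ                             ≤⟨ 1≤powℚ 3 (ℕtoℚ-mono-≤ {1} {4 ℕ.* suc d} (s≤s z≤n)) ⟩
      powℚ b 3                       ≡⟨ ℚ.*-identityʳ (powℚ b 3) ⟨
      powℚ b 3 ℚ.* 1ℚ                ≤⟨ *-monoˡ-≤ 0≤b³ 1≤P ⟩
      powℚ b 3 ℚ.* P                 ∎
      where
      L≡0 : L ≡ 0
      L≡0 = ℕ.n≤0⇒n≡0 (subst (L ≤_) (ℕ.*-zeroʳ (suc (2 ℕ.* d))) L≤0)
    a³X≤b³P (suc s) L≤ s³X≤P = begin
      powℚ (ℕtoℚ L ℚ.+ 1ℚ) 3 ℚ.* X                  ≡⟨ cong (λ a → powℚ a 3 ℚ.* X) (sym (ℕtoℚ-+ L 1)) ⟩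
      powℚ (ℕtoℚ (L ℕ.+ 1)) 3 ℚ.* X                 ≤⟨ *-monoʳ-≤ 0≤X (powℚ-mono-≤ 3 (0≤ℕtoℚ (L ℕ.+ 1)) (ℕtoℚ-mono-≤ {L ℕ.+ 1} L+1≤4ts)) ⟩
      powℚ (ℕtoℚ (4 ℕ.* suc d ℕ.* suc s)) 3 ℚ.* X   ≡⟨ cong (λ z → powℚ z 3 ℚ.* X) (ℕtoℚ-* (4 ℕ.* suc d) (suc s)) ⟩
      powℚ (b ℚ.* ℕtoℚ (suc s)) 3 ℚ.* X             ≡⟨ cong (ℚ._* X) (powℚ-distrib-* b (ℕtoℚ (suc s)) 3) ⟩
      powℚ b 3 ℚ.* powℚ (ℕtoℚ (suc s)) 3 ℚ.* X      ≡⟨ ℚ.*-assoc (powℚ b 3) (powℚ (ℕtoℚ (suc s)) 3) X ⟩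
      powℚ b 3 ℚ.* (powℚ (ℕtoℚ (suc s)) 3 ℚ.* X)    ≤⟨ *-monoˡ-≤ 0≤b³ s³X≤P ⟩
      powℚ b 3 ℚ.* P                                ∎
      where
      L+1≤4ts : L ℕ.+ 1 ≤ 4 ℕ.* suc d ℕ.* suc s
      L+1≤4ts = ℕ.≤-trans (ℕ.+-mono-≤ L≤ (s≤s z≤n)) (subst (_≤ 4 ℕ.* suc d ℕ.* suc s) (sym (double d s))
        (ℕ.*-monoˡ-≤ (suc s) (ℕ.*-monoˡ-≤ (suc d) {2} {4} (ℕ.s≤s (ℕ.s≤s z≤n)))))
        where
        double : ∀ d s → suc (2 ℕ.* d) ℕ.* suc s ℕ.+ suc s ≡ 2 ℕ.* suc d ℕ.* suc s
        double = solve-∀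

  module Configuration {q} (F : FiniteField q) {n L : ℕ} (x y : Fin L → Vecₙ F n)
    (x-injective : Injective _≡_ _≡_ x) (y-injective : Injective _≡_ _≡_ y)
    {α β : FiniteField.Carrier F} (α≢0 : α ≢ FiniteField.0# F) (β≢0 : β ≢ FiniteField.0# F) where

    open Field F
    open Tricoloured F using (TricolouredSumFree; tricolouredSumFree-bound; TricolouredSumFree-allVecs)

    point : Fin L → Fin L → Vecₙ F n
    point a b = vadd F (scale F α (x a)) (scale F β (y b))

    Solution : Fin L → Fin L × Fin L → Set
    Solution i p = proj₁ p ≢ i × proj₂ p ≢ i × point (proj₁ p) (proj₂ p) ≡ point i i

    solution? : ∀ i p → Dec (Solution i p)
    solution? i p =
      ¬? (proj₁ p Fin.≟ i) ×-dec ¬? (proj₂ p Fin.≟ i) ×-dec Vec.≡-dec _≟_ (point (proj₁ p) (proj₂ p)) (point i i)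

    pairs : List (Fin L × Fin L)
    pairs = cartesianProduct (allFin L) (allFin L)

    solutions : Fin L → List (Fin L × Fin L)
    solutions i = filter (solution? i) pairs

    many-solutions : ∀ {t} i → t ≤ length (solutions i) →
      ∃ λ (g : Fin t → Fin L × Fin L) → Injective _≡_ _≡_ g × ((k : Fin t) → Solution i (g k))
    many-solutions {t} i t≤ =
      g , g-injective , λ k → proj₂ (∈-filter⁻ (solution? i) {xs = pairs} (∈-lookup (Fin.inject≤ k t≤)))
      where
      g : Fin t → Fin L × Fin L
      g = lookup (solutions i) ∘ (λ k → Fin.inject≤ k t≤)
      g-injective : Injective _≡_ _≡_ g
      g-injective {k} {l} gk≡gl = Fin.inject≤-injective t≤ t≤ k l
        (lookup-injective (filter⁺ (solution? i) (cartesianProduct⁺ (allFin⁺ L) (allFin⁺ L))) _ _ gk≡gl)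

    Conflict : Fin L → Fin L → Set
    Conflict i a = Any (λ b → Solution i (a , b)) (allFin L)

    conflict? : ∀ i a → Dec (Conflict i a)
    conflict? i a = any? (λ b → solution? i (a , b)) (allFin L)

    conflict-irreflexive : ∀ i → ¬ Conflict i i
    conflict-irreflexive i conflict = proj₁ (proj₂ (proj₂ (find conflict))) refl

    open IndependentSet Conflict conflict? using (outdegree; Independent; independentSet)

    outdegree≤solutions : ∀ i → outdegree i ≤ length (solutions i)
    outdegree≤solutions i = begin
      ∑[ a ← allFin L ] when (conflict? i a) 1
        ≤⟨ ∑-mono-≤ (allFin L) (λ a → when-any≤∑ (λ b → solution? i (a , b)) (allFin L)) ⟩
      ∑[ a ← allFin L ] ∑[ b ← allFin L ] when (solution? i (a , b)) 1
        ≡⟨ ∑-cartesianProductWith _,_ (allFin L) (allFin L) (λ p → when (solution? i p) 1) ⟨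
      ∑[ p ← pairs ] when (solution? i p) 1
        ≡⟨ length-filter≡∑ (solution? i) pairs ⟨
      length (solutions i) ∎
      where open ℕ.≤-Reasoning

    module _ {S : List (Fin L)} (independent : Independent S) where

      point≡point⇒trivial : ∀ {a b c} → a ∈ S → b ∈ S → c ∈ S → point a b ≡ point c c → a ≡ b × b ≡ c
      point≡point⇒trivial {a} {b} {c} a∈S b∈S c∈S eq with a Fin.≟ c | b Fin.≟ c
      ... | yes refl | _ = sym b≡a , b≡a
        where
        b≡a : b ≡ a
        b≡a = y-injective (scale-injective β≢0 (y b) (y a) (vadd-cancelˡ (scale F α (x a)) _ _ eq))
      ... | no a≢c | yes refl =
        contradiction (x-injective (scale-injective α≢0 (x a) (x b) (vadd-cancelʳ (scale F β (y b)) _ _ eq))) a≢c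
      ... | no a≢c | no b≢c = contradiction (Any.map (λ { refl → a≢c , b≢c , eq }) (∈-allFin b)) (independent c∈S a∈S)

      sumFree : TricolouredSumFree (scale F α ∘ x) (scale F β ∘ y) (Vec.map -_ ∘ λ c → point c c) S
      sumFree = record
        { sum≡0⇒diagonal = λ a∈S b∈S c∈S sum≡0 → point≡point⇒trivial a∈S b∈S c∈S (vadd-neg≡0 _ _ _ sum≡0)
        ; diagonal-sum≡0 = λ {a} _ → vadd-neg-vadd≡0 (scale F α (x a)) (scale F β (y a))
        }

      power-bound : Unique S → ∀ k → length S ℕ.^ k ≤ 3 ℕ.* length (smallVectors q (k ℕ.* n))
      power-bound S! k = subst (_≤ 3 ℕ.* length (smallVectors q (k ℕ.* n))) (length-allVecs S k)
        (tricolouredSumFree-bound (Vec.≡-dec Fin._≟_) (allVecs⁺ k S!) (TricolouredSumFree-allVecs sumFree k))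

    -- ε = 1 suffices since L + 1 ≤ 4 t |S|.
    few-solutions⇒¬LGe4tN₀ : ∀ d → (∀ i → length (solutions i) ≤ d) → ¬ LGe4tN₀ q n (suc d) L
    few-solutions⇒¬LGe4tN₀ d few large
      with independentSet (λ i → ℕ.≤-trans (outdegree≤solutions i) (few i)) conflict-irreflexive
         | large 1ℚ (ℚ.positive⁻¹ 1ℚ)
    ... | S , S! , independent , L≤ | x₀ , 0<x , x<1 , b³G³ⁿ<a³X =
      cube-comparison d L (length S) L≤ (0≤powℚ (n ℕ.* (q ∸ 1)) 0≤x) (powℚ≤1 (n ℕ.* (q ∸ 1)) 0≤x x≤1)
        (1≤powℚ (3 ℕ.* n) (1≤geomSum q 1≤q 0≤x))
        (tensorPower-bound q n (length S) 1≤q 0≤x x≤1 (power-bound independent S!))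
        b³G³ⁿ<a³X
      where
      0≤x : 0ℚ ℚ.≤ x₀
      0≤x = ℚ.<⇒≤ 0<x
      x≤1 : x₀ ℚ.≤ 1ℚ
      x≤1 = ℚ.<⇒≤ x<1

    witness : ∀ d → LGe4tN₀ q n (suc d) L →
      ∃[ i ] ∃ λ (g : Fin (suc d) → Fin L × Fin L) → Injective _≡_ _≡_ g × ((k : Fin (suc d)) → Solution i (g k))
    witness d large with any? (λ i → suc d ℕ.≤? length (solutions i)) (allFin L)
    ... | yes many with find many
    ...   | i , _ , t≤ = i , many-solutions i t≤
    witness d large | no few = contradiction large (few-solutions⇒¬LGe4tN₀ d (λ i → ℕ.≤-pred (ℕ.≰⇒> (λ many →
      few (Any.map (λ { refl → many }) (∈-allFin i))))))

open import Data.Nat using (suc; _≤_)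
open import Data.Product using (∃; ∃-syntax; _×_; proj₁; proj₂)
open import Function.Definitions using (Injective)
open import Relation.Binary.PropositionalEquality using (_≡_; _≢_)

lemma6p1 : (q : ℕ) → IsPrimePower q → (F : FiniteField q) →
    (n t L : ℕ) → 1 ≤ t →
    (x y : Fin L → Vecₙ F n) →
    Injective _≡_ _≡_ x → Injective _≡_ _≡_ y →
    (α β : FiniteField.Carrier F) →
    α ≢ FiniteField.0# F → β ≢ FiniteField.0# F →
    LGe4tN₀ q n t L →
    ∃[ i ] ∃ λ (g : Fin t → Fin L × Fin L) → (Injective _≡_ _≡_ g ×
      ((k : Fin t) →
        proj₁ (g k) ≢ i × proj₂ (g k) ≢ i ×
        vadd F (scale F α (x (proj₁ (g k)))) (scale F β (y (proj₂ (g k))))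
          ≡ vadd F (scale F α (x i)) (scale F β (y i))))
lemma6p1 q _ F n (suc d) L _ x y x-injective y-injective α β α≢0 β≢0 =
  Solutions.Configuration.witness F x y x-injective y-injective α≢0 β≢0 d
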